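{- Let $n\ge 1$ and let $T$ be a tree on $2n$ vertices, one of which has degree $n$. If the chromatic symmetric function $X_T(\mathbf{x})$ is Schur positive, then there is some partition $\nu$ of $n-1$ such that $T$ is isomorphic to $T(\nu)$.
   Context: For a finite simple graph $G=(V,E)$, a proper coloring is a function $\kappa:V\to\mathbb{P}$ (positive integers) with $\kappa(v)\neq\kappa(w)$ whenever $\{v,w\}\in E$. With commuting variables $\mathbf{x}=\{x_i: i\in\mathbb{P}\}$, the chromatic symmetric function is $X_G(\mathbf{x})=\sum_{\kappa}\prod_{v\in V}x_{\kappa(v)}$, the sum over all proper colorings $\kappa$ of $G$. A symmetric function is Schur positive if all coefficients in its expansion in the basis of Schur functions are nonnegative. For a partition $\nu=(\nu_1,\ldots,\nu_t)$ of $n-1$, $T(\nu)$ denotes the tree on $2n$ vertices consisting of a vertex $v$ with exactly $n$ neighbors $v_1,\ldots,v_n$, where for $1\le i\le t$ the vertex $v_i$ has exactly $\nu_i$ neighbors other than $v$, each of which is a leaf, and $v_{t+1},\ldots,v_n$ are leaves (this determines $T(\nu)$ up to isomorphism). -}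

module Defs where

open import Data.Bool using (Bool; true; false; _∧_; _∨_; not; if_then_else_)
open import Data.Nat using (ℕ; zero; suc; _+_; _*_; _∸_; _≤_; _≡ᵇ_; _<ᵇ_; _≤ᵇ_; _⊓_)
open import Data.Fin using (Fin; toℕ)
open import Data.List using (List; []; _∷_; map; concatMap; length; upTo; allFin; concat; zip; _∷ʳ_)
open import Data.Nat.ListAction using (sum)
open import Data.List.Relation.Unary.All using (All)
open import Data.List.Relation.Unary.Linked using (Linked)
open import Data.List.Relation.Unary.Unique.Propositional using (Unique)
open import Data.Maybe using (Maybe; just; nothing)
open import Data.Product using (Σ; ∃; _×_; _,_; proj₁; proj₂)
open import Data.Vec.Functional using () renaming (_∷_ to _∷ᶠ_)
open import Function.Bundles using (_↔_; Inverse)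
open import Relation.Binary.PropositionalEquality using (_≡_)
open import Relation.Nullary using (¬_)

Adjacency : ℕ → Set
Adjacency m = Fin m → Fin m → Bool

IsSimple : ∀ {m} → Adjacency m → Set
IsSimple {m} adj = (∀ u w → adj u w ≡ adj w u) × (∀ u → adj u u ≡ false)

allB : ∀ {A : Set} → (A → Bool) → List A → Bool
allB p [] = true
allB p (x ∷ xs) = p x ∧ allB p xs

countB : ∀ {A : Set} → (A → Bool) → List A → ℕ
countB p [] = 0
countB p (x ∷ xs) = if p x then suc (countB p xs) else countB p xs

degree : ∀ {m} → Adjacency m → Fin m → ℕ
degree {m} adj v = countB (adj v) (allFin m)

data Walk {m} (adj : Adjacency m) : Fin m → Fin m → Set where
  here : ∀ {u} → Walk adj u u
  step : ∀ {u v w} → adj u v ≡ true → Walk adj v w → Walk adj u w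

Connected : ∀ {m} → Adjacency m → Set
Connected adj = ∀ u w → Walk adj u w

Adj : ∀ {m} → Adjacency m → Fin m → Fin m → Set
Adj adj u w = adj u w ≡ true

IsCycle : ∀ {m} → Adjacency m → Fin m → List (Fin m) → Set
IsCycle adj v rest =
  (2 ≤ length rest) × Unique (v ∷ rest) × Linked (Adj adj) ((v ∷ rest) ∷ʳ v)

Acyclic : ∀ {m} → Adjacency m → Set
Acyclic adj = ∀ v rest → ¬ IsCycle adj v rest

IsTree : ∀ {m} → Adjacency m → Set
IsTree adj = Connected adj × Acyclic adj

Isomorphic : ∀ {m m'} → Adjacency m → Adjacency m' → Set
Isomorphic {m} {m'} adj adj' =
  Σ (Fin m ↔ Fin m') λ f → ∀ u w → adj u w ≡ adj' (Inverse.to f u) (Inverse.to f w)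

IsPartition : ℕ → List ℕ → Set
IsPartition k ν = All (λ p → 1 ≤ p) ν × Linked (λ a b → b ≤ a) ν × sum ν ≡ k

-- enumeration of partitions of d with all parts ≤ b (fuel f ≥ d)
partsFuel : ℕ → ℕ → ℕ → List (List ℕ)
partsFuel f zero b = [] ∷ []
partsFuel zero (suc d) b = []
partsFuel (suc f) (suc d) b =
  concatMap (λ p → map (p ∷_) (partsFuel f (suc d ∸ p) p)) (map suc (upTo (b ⊓ suc d)))

partitions : ℕ → List (List ℕ)
partitions d = partsFuel d d d

-- Monomial coefficients.  A monomial x_1^{α_1} ... x_k^{α_k} is given by
-- the list α = (α_1, ..., α_k) (colours/entries 0..k-1 stand for 1..k).

occ : ℕ → List ℕ → ℕ
occ i = countB (λ x → x ≡ᵇ i)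

allFuns : (m k : ℕ) → List (Fin m → Fin k)
allFuns zero k = (λ ()) ∷ []
allFuns (suc m) k = concatMap (λ c → map (λ f → c ∷ᶠ f) (allFuns m k)) (allFin k)

properB : ∀ {m k} → Adjacency m → (Fin m → Fin k) → Bool
properB {m} adj κ =
  allB (λ u → allB (λ w → not (adj u w) ∨ not (toℕ (κ u) ≡ᵇ toℕ (κ w))) (allFin m)) (allFin m)

colContentB : ∀ {m k} → (Fin m → Fin k) → List ℕ → Bool
colContentB {m} {k} κ α =
  allB (λ ia → countB (λ u → toℕ (κ u) ≡ᵇ proj₁ ia) (allFin m) ≡ᵇ proj₂ ia) (zip (upTo k) α)

-- coefficient of x^α in the chromatic symmetric function X_G
chromCoeff : ∀ {m} → Adjacency m → List ℕ → ℕ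
chromCoeff {m} adj α =
  countB (λ κ → properB adj κ ∧ colContentB κ α) (allFuns m (length α))

lists : ℕ → ℕ → List (List ℕ)
lists zero k = [] ∷ []
lists (suc L) k = concatMap (λ x → map (x ∷_) (lists L k)) (upTo k)

fillings : List ℕ → ℕ → List (List (List ℕ))
fillings [] k = [] ∷ []
fillings (r ∷ rs) k = concatMap (λ row → map (row ∷_) (fillings rs k)) (lists r k)

rowWeakB : List ℕ → Bool
rowWeakB [] = true
rowWeakB (x ∷ []) = true
rowWeakB (x ∷ y ∷ ys) = (x ≤ᵇ y) ∧ rowWeakB (y ∷ ys)

colStrictB : List ℕ → List ℕ → Bool
colStrictB _ [] = true
colStrictB [] (_ ∷ _) = false
colStrictB (x ∷ xs) (y ∷ ys) = (x <ᵇ y) ∧ colStrictB xs ys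

colsB : List (List ℕ) → Bool
colsB [] = true
colsB (r ∷ []) = true
colsB (r ∷ r' ∷ rs) = colStrictB r r' ∧ colsB (r' ∷ rs)

ssytB : List (List ℕ) → Bool
ssytB t = allB rowWeakB t ∧ colsB t

tabContentB : List (List ℕ) → List ℕ → Bool
tabContentB t α =
  allB (λ ia → occ (proj₁ ia) (concat t) ≡ᵇ proj₂ ia) (zip (upTo (length α)) α)

-- coefficient of x^α in the Schur function s_μ: number of SSYT of shape μ
-- and content α
schurCoeff : List ℕ → List ℕ → ℕ
schurCoeff μ α = countB (λ t → ssytB t ∧ tabContentB t α) (fillings μ (length α))

-- A homogeneous symmetric function of degree d, given by its monomial
-- coefficients c, is Schur positive: it equals Σ_{μ ⊢ d} a_μ s_μ with all
-- a_μ nonnegative (coefficients compared monomial by monomial).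
SchurPositive : ℕ → (List ℕ → ℕ) → Set
SchurPositive d c =
  ∃ λ (a : List ℕ → ℕ) →
    ∀ α → c α ≡ sum (map (λ μ → a μ * schurCoeff μ α) (partitions d))

-- The tree T(ν) on 2n vertices.
-- vertex 0 = v; vertices 1..n = v_1..v_n (adjacent to v);
-- vertices n+1 .. 2n-1 are leaves; leaf n+1+j hangs off v_{1+owner ν j},
-- where the first ν_1 leaves hang off v_1, the next ν_2 off v_2, etc.

owner : List ℕ → ℕ → ℕ
owner [] j = 0
owner (p ∷ ps) j = if j <ᵇ p then 0 else suc (owner ps (j ∸ p))

parentT : ℕ → List ℕ → ℕ → Maybe ℕ
parentT n ν zero = nothing
parentT n ν (suc k) =
  if suc k ≤ᵇ n then just 0 else just (suc (owner ν (suc k ∸ suc n)))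

isParentB : ℕ → List ℕ → ℕ → ℕ → Bool
isParentB n ν u w with parentT n ν u
... | nothing = false
... | just p = p ≡ᵇ w

Tν : (n : ℕ) → List ℕ → Adjacency (2 * n)
Tν n ν u w = isParentB n ν (toℕ u) (toℕ w) ∨ isParentB n ν (toℕ w) (toℕ u)

-- A tree is bipartite, so X_T has a positive coefficient at some x₁ᵃ x₂ᵇ with a + b = 2n. Schur
-- positivity passes this to a Kostka number K_{μ,(a,b)} > 0, and with two letters the tableau can be
-- refilled to give K_{μ,(n,n)} > 0; hence T has a proper 2-colouring with two classes of size n. The
-- class avoiding v then consists exactly of the n neighbours of v, so every vertex is within distance
-- two of v. Such a tree is T(ν), where ν lists the numbers of leaves hanging off the neighbours of v
-- in decreasing order; the isomorphism numbers the vertices in the order used by T(ν).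

module Submission where

open import Defs
open import Data.Bool using (Bool; true; false; _∧_; _∨_; not; if_then_else_; T) renaming (_≟_ to _≟ᴮ_)
open import Data.Bool.Properties using (T-≡; ∧-zeroʳ; ∧-distribˡ-∨)
open import Data.Nat using (ℕ; zero; suc; _+_; _*_; _∸_; _≤_; _<_; z≤n; s≤s; _≡ᵇ_; _<ᵇ_; _≤ᵇ_; parity)
open import Data.Nat.Properties
open import Data.Nat.ListAction using (sum)
open import Data.Nat.Solver using (module +-*-Solver)
open import Data.Parity.Base as ℙ using (Parity; 0ℙ; 1ℙ; _⁻¹)
import Data.Parity.Properties as ℙₚ
open import Data.Fin using (Fin; zero; suc; toℕ; punchOut; fromℕ<)
open import Data.Fin.Properties
  using (toℕ-injective; toℕ-fromℕ<; punchOut-injective; injective⇒≤) renaming (_≟_ to _≟ᶠ_; any? to any?ᶠ)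
open import Data.List using (List; []; _∷_; [_]; _++_; _∷ʳ_; length; map; tabulate; concat; replicate; upTo; allFin)
open import Data.List.Properties using (length-++; ++-assoc; length-replicate; length-tabulate; ++-identityʳ)
open import Data.List.Membership.Propositional using (_∈_; find; lose)
open import Data.List.Membership.Propositional.Properties
  using (∈-concatMap⁺; ∈-concatMap⁻; ∈-map⁺; ∈-map⁻; ∈-upTo⁺; ∈-upTo⁻; ∈-allFin; ∈-∃++)
open import Data.List.Relation.Unary.All using (All; []; _∷_)
import Data.List.Relation.Unary.All.Properties as All
open import Data.List.Relation.Unary.AllPairs using ([]; _∷_)
open import Data.List.Relation.Unary.Any using (here; there; any?)
open import Data.List.Relation.Unary.Linked using (Linked; []; [-]; _∷_)
open import Data.List.Relation.Unary.Unique.Propositional using (Unique)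
open import Data.Vec.Functional using () renaming (_∷_ to _∷ᶠ_)
open import Data.Maybe using (just; nothing)
open import Data.Product using (∃; _×_; _,_; proj₁; proj₂)
open import Data.Sum using (_⊎_; inj₁; inj₂)
open import Data.Empty using (⊥; ⊥-elim)
open import Function.Bundles using (Equivalence; mk↔ₛ′)
open import Relation.Binary.Definitions using (tri<; tri≈; tri>)
open import Relation.Binary.PropositionalEquality hiding ([_])
open import Relation.Nullary using (¬_; yes; no)

true⇒T : ∀ {b} → b ≡ true → T b
true⇒T = Equivalence.from T-≡

T⇒true : ∀ {b} → T b → b ≡ true
T⇒true = Equivalence.to T-≡

≡ᵇ-true⇒≡ : ∀ {m n} → (m ≡ᵇ n) ≡ true → m ≡ n
≡ᵇ-true⇒≡ {m} {n} e = ≡ᵇ⇒≡ m n (true⇒T e)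

≡⇒≡ᵇ-true : ∀ {m n} → m ≡ n → (m ≡ᵇ n) ≡ true
≡⇒≡ᵇ-true {m} {n} e = T⇒true (≡⇒≡ᵇ m n e)

≢⇒≡ᵇ-false : ∀ {m n} → m ≢ n → (m ≡ᵇ n) ≡ false
≢⇒≡ᵇ-false {m} {n} m≢n with m ≡ᵇ n in eq
... | true = ⊥-elim (m≢n (≡ᵇ-true⇒≡ eq))
... | false = refl

<ᵇ-true⇒< : ∀ {m n} → (m <ᵇ n) ≡ true → m < n
<ᵇ-true⇒< {m} {n} e = <ᵇ⇒< m n (true⇒T e)

<⇒<ᵇ-true : ∀ {m n} → m < n → (m <ᵇ n) ≡ true
<⇒<ᵇ-true m<n = T⇒true (<⇒<ᵇ m<n)

≮⇒<ᵇ-false : ∀ {m n} → ¬ m < n → (m <ᵇ n) ≡ false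
≮⇒<ᵇ-false {m} {n} m≮n with m <ᵇ n in eq
... | true = ⊥-elim (m≮n (<ᵇ-true⇒< eq))
... | false = refl

≤ᵇ-true⇒≤ : ∀ {m n} → (m ≤ᵇ n) ≡ true → m ≤ n
≤ᵇ-true⇒≤ {m} {n} e = ≤ᵇ⇒≤ m n (true⇒T e)

≤⇒≤ᵇ-true : ∀ {m n} → m ≤ n → (m ≤ᵇ n) ≡ true
≤⇒≤ᵇ-true m≤n = T⇒true (≤⇒≤ᵇ m≤n)

∧-true⁻ : ∀ {a b} → a ∧ b ≡ true → a ≡ true × b ≡ true
∧-true⁻ {true} {true} _ = refl , refl

∧-true⁺ : ∀ {a b} → a ≡ true → b ≡ true → a ∧ b ≡ true
∧-true⁺ refl refl = refl

∨-true⁻ : ∀ {a b} → a ∨ b ≡ true → a ≡ true ⊎ b ≡ true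
∨-true⁻ {true} _ = inj₁ refl
∨-true⁻ {false} e = inj₂ e

∨-true⁺ˡ : ∀ {a b} → a ≡ true → a ∨ b ≡ true
∨-true⁺ˡ refl = refl

∨-true⁺ʳ : ∀ {a b} → b ≡ true → a ∨ b ≡ true
∨-true⁺ʳ {true} _ = refl
∨-true⁺ʳ {false} e = e

not-true⁻ : ∀ {a} → not a ≡ true → a ≡ false
not-true⁻ {false} _ = refl

true⇔true⇒≡ : ∀ {a b} → (a ≡ true → b ≡ true) → (b ≡ true → a ≡ true) → a ≡ b
true⇔true⇒≡ {true} a⇒b _ = sym (a⇒b refl)
true⇔true⇒≡ {false} {true} _ b⇒a = b⇒a refl
true⇔true⇒≡ {false} {false} _ _ = refl

module _ {A : Set} where

  countB≤length : (P : A → Bool) (xs : List A) → countB P xs ≤ length xs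
  countB≤length P [] = z≤n
  countB≤length P (x ∷ xs) with P x
  ... | true = s≤s (countB≤length P xs)
  ... | false = m≤n⇒m≤1+n (countB≤length P xs)

  countB-true : (xs : List A) → countB (λ _ → true) xs ≡ length xs
  countB-true [] = refl
  countB-true (x ∷ xs) = cong suc (countB-true xs)

  countB-zero : (P : A → Bool) → (∀ x → P x ≡ false) → ∀ xs → countB P xs ≡ 0
  countB-zero P P≡false [] = refl
  countB-zero P P≡false (x ∷ xs) rewrite P≡false x = countB-zero P P≡false xs

  countB-cong : (P Q : A → Bool) → (∀ x → P x ≡ Q x) → ∀ xs → countB P xs ≡ countB Q xs
  countB-cong P Q P≡Q [] = refl
  countB-cong P Q P≡Q (x ∷ xs) rewrite P≡Q x with Q x
  ... | true = cong suc (countB-cong P Q P≡Q xs)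
  ... | false = countB-cong P Q P≡Q xs

  countB-mono : (P Q : A → Bool) → (∀ x → P x ≡ true → Q x ≡ true) →
                ∀ xs → countB P xs ≤ countB Q xs
  countB-mono P Q P⇒Q [] = z≤n
  countB-mono P Q P⇒Q (x ∷ xs) with P x in p | Q x in q
  ... | true | true = s≤s (countB-mono P Q P⇒Q xs)
  ... | true | false with () ← trans (sym (P⇒Q x p)) q
  ... | false | true = m≤n⇒m≤1+n (countB-mono P Q P⇒Q xs)
  ... | false | false = countB-mono P Q P⇒Q xs

  countB-mono-< : (P Q : A → Bool) → (∀ x → P x ≡ true → Q x ≡ true) →
                  ∀ {y} xs → y ∈ xs → P y ≡ false → Q y ≡ true → countB P xs < countB Q xs
  countB-mono-< P Q P⇒Q (x ∷ xs) (here refl) py qy rewrite py | qy = s≤s (countB-mono P Q P⇒Q xs)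
  countB-mono-< P Q P⇒Q (x ∷ xs) (there y∈xs) py qy with P x in p | Q x in q
  ... | true | true = s≤s (countB-mono-< P Q P⇒Q xs y∈xs py qy)
  ... | true | false with () ← trans (sym (P⇒Q x p)) q
  ... | false | true = m≤n⇒m≤1+n (countB-mono-< P Q P⇒Q xs y∈xs py qy)
  ... | false | false = countB-mono-< P Q P⇒Q xs y∈xs py qy

  countB-mono-≡ : (P Q : A → Bool) → (∀ x → P x ≡ true → Q x ≡ true) → ∀ xs →
                  countB P xs ≡ countB Q xs → ∀ {y} → y ∈ xs → Q y ≡ true → P y ≡ true
  countB-mono-≡ P Q P⇒Q xs eq {y} y∈xs qy with P y in py
  ... | true = refl
  ... | false = ⊥-elim (<-irrefl eq (countB-mono-< P Q P⇒Q xs y∈xs py qy))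

  countB-pos⁻ : (P : A → Bool) → ∀ xs → 0 < countB P xs → ∃ λ x → x ∈ xs × P x ≡ true
  countB-pos⁻ P (x ∷ xs) pos with P x in px
  ... | true = x , here refl , px
  ... | false with y , y∈xs , py ← countB-pos⁻ P xs pos = y , there y∈xs , py

  countB-pos⁺ : (P : A → Bool) → ∀ {y} xs → y ∈ xs → P y ≡ true → 0 < countB P xs
  countB-pos⁺ P (x ∷ xs) (here refl) py rewrite py = s≤s z≤n
  countB-pos⁺ P (x ∷ xs) (there y∈xs) py with P x
  ... | true = s≤s z≤n
  ... | false = countB-pos⁺ P xs y∈xs py

  countB-∨ : (P Q : A → Bool) → (∀ x → P x ≡ true → Q x ≡ false) → ∀ xs →
             countB (λ x → P x ∨ Q x) xs ≡ countB P xs + countB Q xs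
  countB-∨ P Q disjoint [] = refl
  countB-∨ P Q disjoint (x ∷ xs) with P x in p | Q x in q
  ... | true | true with () ← trans (sym (disjoint x p)) q
  ... | true | false = cong suc (countB-∨ P Q disjoint xs)
  ... | false | true = trans (cong suc (countB-∨ P Q disjoint xs)) (sym (+-suc _ _))
  ... | false | false = countB-∨ P Q disjoint xs

  countB-++ : (P : A → Bool) (xs ys : List A) → countB P (xs ++ ys) ≡ countB P xs + countB P ys
  countB-++ P [] ys = refl
  countB-++ P (x ∷ xs) ys with P x
  ... | true = cong suc (countB-++ P xs ys)
  ... | false = countB-++ P xs ys

  countB-replicate-true : (P : A → Bool) (k : ℕ) {x : A} → P x ≡ true → countB P (replicate k x) ≡ k
  countB-replicate-true P zero px = refl
  countB-replicate-true P (suc k) px rewrite px = cong suc (countB-replicate-true P k px)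

  countB-replicate-false : (P : A → Bool) (k : ℕ) {x : A} → P x ≡ false → countB P (replicate k x) ≡ 0
  countB-replicate-false P zero px = refl
  countB-replicate-false P (suc k) px rewrite px = countB-replicate-false P k px

-- Two-letter Kostka numbers and Schur positivity

∈-lists⁻ : ∀ L k r → r ∈ lists L k → length r ≡ L × All (_< k) r
∈-lists⁻ zero k .[] (here refl) = refl , []
∈-lists⁻ (suc L) k r r∈
  with x , x∈ , r∈′ ← find (∈-concatMap⁻ (λ x → map (x ∷_) (lists L k)) {xs = upTo k} r∈)
  with r′ , r′∈ , refl ← ∈-map⁻ (x ∷_) r∈′
  with len≡ , r′<k ← ∈-lists⁻ L k r′ r′∈ = cong suc len≡ , ∈-upTo⁻ x∈ ∷ r′<k

∈-lists⁺ : ∀ L k r → length r ≡ L → All (_< k) r → r ∈ lists L k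
∈-lists⁺ zero k [] _ _ = here refl
∈-lists⁺ (suc L) k (x ∷ r) len≡ (x<k ∷ r<k) =
  ∈-concatMap⁺ (λ x → map (x ∷_) (lists L k))
    (lose (∈-upTo⁺ x<k) (∈-map⁺ (x ∷_) (∈-lists⁺ L k r (suc-injective len≡) r<k)))

∈-fillings⁻ : ∀ μ k t → t ∈ fillings μ k → map length t ≡ μ × All (All (_< k)) t
∈-fillings⁻ [] k .[] (here refl) = refl , []
∈-fillings⁻ (l ∷ μ) k t t∈
  with row , row∈ , t∈′ ← find (∈-concatMap⁻ (λ row → map (row ∷_) (fillings μ k)) {xs = lists l k} t∈)
  with t′ , t′∈ , refl ← ∈-map⁻ (row ∷_) t∈′
  with shape , t′<k ← ∈-fillings⁻ μ k t′ t′∈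
  with len≡ , row<k ← ∈-lists⁻ l k row row∈ = cong₂ _∷_ len≡ shape , row<k ∷ t′<k

∈-fillings⁺ : ∀ μ k t → map length t ≡ μ → All (All (_< k)) t → t ∈ fillings μ k
∈-fillings⁺ [] k [] _ _ = here refl
∈-fillings⁺ (l ∷ μ) k (r ∷ t) refl (r<k ∷ t<k) =
  ∈-concatMap⁺ (λ row → map (row ∷_) (fillings μ k))
    (lose (∈-lists⁺ l k r refl r<k) (∈-map⁺ (r ∷_) (∈-fillings⁺ μ k t refl t<k)))

SSYT : List ℕ → List ℕ → List (List ℕ) → Set
SSYT μ α t = t ∈ fillings μ (length α) × (ssytB t ∧ tabContentB t α) ≡ true

schurCoeff-pos⁻ : ∀ μ α → 0 < schurCoeff μ α → ∃ (SSYT μ α)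
schurCoeff-pos⁻ μ α pos with t , t∈ , ok ← countB-pos⁻ _ (fillings μ (length α)) pos = t , t∈ , ok

schurCoeff-pos⁺ : ∀ μ α t → SSYT μ α t → 0 < schurCoeff μ α
schurCoeff-pos⁺ μ α t (t∈ , ok) = countB-pos⁺ _ (fillings μ (length α)) t∈ ok

tabContentB₂⁻ : ∀ t {a b} → tabContentB t (a ∷ b ∷ []) ≡ true → occ 0 (concat t) ≡ a × occ 1 (concat t) ≡ b
tabContentB₂⁻ t ok with ok₀ , ok′ ← ∧-true⁻ ok with ok₁ , _ ← ∧-true⁻ ok′ =
  ≡ᵇ-true⇒≡ ok₀ , ≡ᵇ-true⇒≡ ok₁

tabContentB₂⁺ : ∀ t {a b} → occ 0 (concat t) ≡ a → occ 1 (concat t) ≡ b → tabContentB t (a ∷ b ∷ []) ≡ true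
tabContentB₂⁺ t e₀ e₁ = ∧-true⁺ (≡⇒≡ᵇ-true e₀) (∧-true⁺ (≡⇒≡ᵇ-true e₁) refl)

length≡occ₀+occ₁ : ∀ xs → All (_< 2) xs → length xs ≡ occ 0 xs + occ 1 xs
length≡occ₀+occ₁ [] [] = refl
length≡occ₀+occ₁ (zero ∷ xs) (_ ∷ xs<2) = cong suc (length≡occ₀+occ₁ xs xs<2)
length≡occ₀+occ₁ (suc zero ∷ xs) (_ ∷ xs<2) = trans (cong suc (length≡occ₀+occ₁ xs xs<2)) (sym (+-suc _ _))
length≡occ₀+occ₁ (suc (suc x) ∷ xs) (s≤s (s≤s ()) ∷ _)

row01 : ℕ → ℕ → List ℕ
row01 i j = replicate i 0 ++ replicate j 1

length-row01 : ∀ i j → length (row01 i j) ≡ i + j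
length-row01 i j = trans (length-++ (replicate i 0)) (cong₂ _+_ (length-replicate i) (length-replicate j))

occ₀-row01 : ∀ i j → occ 0 (row01 i j) ≡ i
occ₀-row01 i j = trans (countB-++ _ (replicate i 0) (replicate j 1))
  (trans (cong₂ _+_ (countB-replicate-true _ i refl) (countB-replicate-false _ j refl)) (+-identityʳ i))

occ₁-row01 : ∀ i j → occ 1 (row01 i j) ≡ j
occ₁-row01 i j = trans (countB-++ _ (replicate i 0) (replicate j 1))
  (cong₂ _+_ (countB-replicate-false _ i refl) (countB-replicate-true _ j refl))

row01<2 : ∀ i j → All (_< 2) (row01 i j)
row01<2 i j = All.++⁺ (All.replicate⁺ i (s≤s z≤n)) (All.replicate⁺ j (s≤s (s≤s z≤n)))

rowWeakB-replicate : ∀ k x → rowWeakB (replicate k x) ≡ true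
rowWeakB-replicate zero x = refl
rowWeakB-replicate (suc zero) x = refl
rowWeakB-replicate (suc (suc k)) x = ∧-true⁺ (≤⇒≤ᵇ-true (≤-refl {x})) (rowWeakB-replicate (suc k) x)

rowWeakB-row01 : ∀ i j → rowWeakB (row01 i j) ≡ true
rowWeakB-row01 zero j = rowWeakB-replicate j 1
rowWeakB-row01 (suc zero) zero = refl
rowWeakB-row01 (suc zero) (suc j) = rowWeakB-replicate (suc j) 1
rowWeakB-row01 (suc (suc i)) j = rowWeakB-row01 (suc i) j

colStrictB-row01 : ∀ i j q → q ≤ i → colStrictB (row01 i j) (replicate q 1) ≡ true
colStrictB-row01 i j zero _ = refl
colStrictB-row01 (suc i) j (suc q) (s≤s q≤i) = colStrictB-row01 i j q q≤i

colStrictB⇒length≤ : ∀ r r′ → colStrictB r r′ ≡ true → length r′ ≤ length r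
colStrictB⇒length≤ _ [] _ = z≤n
colStrictB⇒length≤ (x ∷ r) (y ∷ r′) ok = s≤s (colStrictB⇒length≤ r r′ (proj₂ (∧-true⁻ {x <ᵇ y} ok)))

EmptyRows : List (List ℕ) → Set
EmptyRows = All (_≡ [])

emptyRows-concat : ∀ rs → EmptyRows rs → concat rs ≡ []
emptyRows-concat [] [] = refl
emptyRows-concat ([] ∷ rs) (refl ∷ rs≡[]) = emptyRows-concat rs rs≡[]

emptyRows-colsB : ∀ r rs → EmptyRows rs → colsB (r ∷ rs) ≡ true
emptyRows-colsB r [] [] = refl
emptyRows-colsB r ([] ∷ rs) (refl ∷ rs≡[]) = emptyRows-colsB [] rs rs≡[]

colsB-emptyRows : ∀ rs → colsB ([] ∷ rs) ≡ true → EmptyRows rs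
colsB-emptyRows [] _ = []
colsB-emptyRows ([] ∷ rs) ok = refl ∷ colsB-emptyRows rs ok

-- Columns are strictly increasing, so with two letters a third row would need an entry ≥ 2.
binarySSYT-emptyRows : ∀ r₀ r₁ rs → All (All (_< 2)) (r₀ ∷ r₁ ∷ rs) → colsB (r₀ ∷ r₁ ∷ rs) ≡ true →
                       EmptyRows rs
binarySSYT-emptyRows r₀ r₁ [] _ _ = []
binarySSYT-emptyRows r₀ r₁ ([] ∷ rs) _ ok =
  refl ∷ colsB-emptyRows rs (proj₂ (∧-true⁻ {colStrictB r₁ []} (proj₂ (∧-true⁻ {colStrictB r₀ r₁} ok))))
binarySSYT-emptyRows (w ∷ r₀) (x ∷ r₁) ((y ∷ r₂) ∷ rs) (_ ∷ _ ∷ (y<2 ∷ _) ∷ _) ok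
  with ok₀₁ , ok′ ← ∧-true⁻ {colStrictB (w ∷ r₀) (x ∷ r₁)} ok
  with ok₁₂ , _ ← ∧-true⁻ {colStrictB (x ∷ r₁) (y ∷ r₂)} ok′
  = ⊥-elim (noChainBelow2 (<ᵇ-true⇒< (proj₁ (∧-true⁻ ok₀₁))) (<ᵇ-true⇒< (proj₁ (∧-true⁻ ok₁₂))) y<2)
  where
  noChainBelow2 : ∀ {w x y} → w < x → x < y → y < 2 → ⊥
  noChainBelow2 (s≤s _) (s≤s (s≤s _)) (s≤s (s≤s ()))
binarySSYT-emptyRows [] (x ∷ r₁) _ _ ()
binarySSYT-emptyRows r₀ [] ((y ∷ r₂) ∷ rs) _ ok with () ← proj₂ (∧-true⁻ {colStrictB r₀ []} ok)

halves : ∀ {p q} n → q ≤ p → p + q ≡ n + n → q ≤ n × n ≤ p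
halves {p} {q} n q≤p p+q≡ = q≤n , n≤p
  where
  q≤n : q ≤ n
  q≤n with q ≤? n
  ... | yes q≤n = q≤n
  ... | no q≰n = ⊥-elim (<-irrefl (sym p+q≡) (+-mono-< (<-≤-trans (≰⇒> q≰n) q≤p) (≰⇒> q≰n)))
  n≤p : n ≤ p
  n≤p with n ≤? p
  ... | yes n≤p = n≤p
  ... | no n≰p = ⊥-elim (<-irrefl p+q≡ (+-mono-< (≰⇒> n≰p) (≤-<-trans q≤p (≰⇒> n≰p))))

balanced-oneRow : ∀ μ n r → (r ∷ []) ∈ fillings μ 2 → length r ≡ n + n → SSYT μ (n ∷ n ∷ []) (row01 n n ∷ [])
balanced-oneRow μ n r t∈ len≡ with refl , _ ← ∈-fillings⁻ μ 2 (r ∷ []) t∈ =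
  ∈-fillings⁺ μ 2 t′ (cong (_∷ []) (trans (length-row01 n n) (sym len≡))) (row01<2 n n ∷ []) ,
  ∧-true⁺ (∧-true⁺ (∧-true⁺ (rowWeakB-row01 n n) refl) refl)
          (tabContentB₂⁺ t′ (occ≡ 0 (occ₀-row01 n n)) (occ≡ 1 (occ₁-row01 n n)))
  where
  t′ = row01 n n ∷ []
  occ≡ : ∀ i → occ i (row01 n n) ≡ n → occ i (concat t′) ≡ n
  occ≡ i e = trans (countB-++ _ (row01 n n) []) (trans (+-identityʳ _) e)

length-concat-twoRows : ∀ r₀ r₁ rs → EmptyRows rs → length (concat (r₀ ∷ r₁ ∷ rs)) ≡ length r₀ + length r₁
length-concat-twoRows r₀ r₁ rs rs≡[] = begin
  length (r₀ ++ r₁ ++ concat rs)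
    ≡⟨ length-++ r₀ ⟩
  length r₀ + length (r₁ ++ concat rs)
    ≡⟨ cong (length r₀ +_) (length-++ r₁) ⟩
  length r₀ + (length r₁ + length (concat rs))
    ≡⟨ cong (λ xs → length r₀ + (length r₁ + length xs)) (emptyRows-concat rs rs≡[]) ⟩
  length r₀ + (length r₁ + 0)
    ≡⟨ cong (length r₀ +_) (+-identityʳ (length r₁)) ⟩
  length r₀ + length r₁ ∎
  where open ≡-Reasoning

occ-twoRows : ∀ i r₀ r₁ rs → EmptyRows rs → occ i (concat (r₀ ∷ r₁ ∷ rs)) ≡ occ i r₀ + occ i r₁
occ-twoRows i r₀ r₁ rs rs≡[] = begin
  occ i (r₀ ++ r₁ ++ concat rs)       ≡⟨ countB-++ _ r₀ _ ⟩
  occ i r₀ + occ i (r₁ ++ concat rs)  ≡⟨ cong (λ xs → occ i r₀ + occ i (r₁ ++ xs)) (emptyRows-concat rs rs≡[]) ⟩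
  occ i r₀ + occ i (r₁ ++ [])         ≡⟨ cong (λ xs → occ i r₀ + occ i xs) (++-identityʳ r₁) ⟩
  occ i r₀ + occ i r₁ ∎
  where open ≡-Reasoning

∸+≡ : ∀ {p q} n → n ≤ p → p + q ≡ n + n → p ∸ n + q ≡ n
∸+≡ {p} {q} n n≤p p+q≡ = +-cancelʳ-≡ n _ _ (begin
  p ∸ n + q + n   ≡⟨ +-assoc (p ∸ n) q n ⟩
  p ∸ n + (q + n) ≡⟨ cong (p ∸ n +_) (+-comm q n) ⟩
  p ∸ n + (n + q) ≡⟨ +-assoc (p ∸ n) n q ⟨
  p ∸ n + n + q   ≡⟨ cong (_+ q) (m∸n+n≡m n≤p) ⟩
  p + q           ≡⟨ p+q≡ ⟩
  n + n ∎)
  where open ≡-Reasoning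

-- Rows of lengths p ≥ q are refilled as 0ⁿ1^(p−n) over 1^q; columns stay strict since q ≤ n.
balanced-twoRows : ∀ μ n r₀ r₁ rs → let p = length r₀; q = length r₁ in
                   (r₀ ∷ r₁ ∷ rs) ∈ fillings μ 2 → ssytB (r₀ ∷ r₁ ∷ rs) ≡ true →
                   length (concat (r₀ ∷ r₁ ∷ rs)) ≡ n + n →
                   SSYT μ (n ∷ n ∷ []) (row01 n (p ∸ n) ∷ replicate q 1 ∷ rs)
balanced-twoRows μ n r₀ r₁ rs t∈ ssyt size
  with shape , _ ∷ _ ∷ rs<2 ← ∈-fillings⁻ μ 2 _ t∈
  with rows , cols ← ∧-true⁻ {allB rowWeakB (r₀ ∷ r₁ ∷ rs)} ssyt
  with _ , rows′ ← ∧-true⁻ {rowWeakB r₀} rows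
  with _ , rsWeak ← ∧-true⁻ {rowWeakB r₁} rows′
  = ∈-fillings⁺ μ 2 t′ (trans shape′ shape) (row01<2 n (p ∸ n) ∷ All.replicate⁺ q (s≤s (s≤s z≤n)) ∷ rs<2) ,
    ∧-true⁺ (∧-true⁺ (∧-true⁺ (rowWeakB-row01 n (p ∸ n)) (∧-true⁺ (rowWeakB-replicate q 1) rsWeak))
                     (∧-true⁺ (colStrictB-row01 n (p ∸ n) q q≤n) (emptyRows-colsB (replicate q 1) rs rs≡[])))
            (tabContentB₂⁺ t′ occ₀≡ occ₁≡)
  where
  p = length r₀
  q = length r₁
  t′ = row01 n (p ∸ n) ∷ replicate q 1 ∷ rs
  rs≡[] = binarySSYT-emptyRows r₀ r₁ rs (∈-fillings⁻ μ 2 _ t∈ .proj₂) cols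
  p+q≡ = trans (sym (length-concat-twoRows r₀ r₁ rs rs≡[])) size
  q≤n = proj₁ (halves n (colStrictB⇒length≤ r₀ r₁ (proj₁ (∧-true⁻ cols))) p+q≡)
  n≤p = proj₂ (halves n (colStrictB⇒length≤ r₀ r₁ (proj₁ (∧-true⁻ cols))) p+q≡)
  shape′ : map length t′ ≡ map length (r₀ ∷ r₁ ∷ rs)
  shape′ = cong₂ _∷_ (trans (length-row01 n (p ∸ n)) (m+[n∸m]≡n n≤p)) (cong (_∷ map length rs) (length-replicate q))
  occ₀≡ : occ 0 (concat t′) ≡ n
  occ₀≡ = trans (occ-twoRows 0 (row01 n (p ∸ n)) (replicate q 1) rs rs≡[])
            (trans (cong₂ _+_ (occ₀-row01 n (p ∸ n)) (countB-replicate-false _ q refl)) (+-identityʳ n))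
  occ₁≡ : occ 1 (concat t′) ≡ n
  occ₁≡ = trans (occ-twoRows 1 (row01 n (p ∸ n)) (replicate q 1) rs rs≡[])
            (trans (cong₂ _+_ (occ₁-row01 n (p ∸ n)) (countB-replicate-true _ q refl)) (∸+≡ n n≤p p+q≡))

balancedTableau : ∀ μ n t → t ∈ fillings μ 2 → ssytB t ≡ true → length (concat t) ≡ n + n →
                  ∃ (SSYT μ (n ∷ n ∷ []))
balancedTableau μ n [] t∈ _ size with refl ← m+n≡0⇒m≡0 n (sym size) = [] , t∈ , refl
balancedTableau μ n (r ∷ []) t∈ _ size =
  _ , balanced-oneRow μ n r t∈ (trans (sym (trans (length-++ r) (+-identityʳ _))) size)
balancedTableau μ n (r₀ ∷ r₁ ∷ rs) t∈ ssyt size = _ , balanced-twoRows μ n r₀ r₁ rs t∈ ssyt size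

binaryTableau-size : ∀ μ t {a b} → t ∈ fillings μ 2 → tabContentB t (a ∷ b ∷ []) ≡ true →
                     length (concat t) ≡ a + b
binaryTableau-size μ t t∈ content with occ₀≡ , occ₁≡ ← tabContentB₂⁻ t content =
  trans (length≡occ₀+occ₁ (concat t) (All.concat⁺ (proj₂ (∈-fillings⁻ μ 2 t t∈)))) (cong₂ _+_ occ₀≡ occ₁≡)

kostka-balance : ∀ μ {a b} n → a + b ≡ n + n → 0 < schurCoeff μ (a ∷ b ∷ []) → 0 < schurCoeff μ (n ∷ n ∷ [])
kostka-balance μ {a} {b} n a+b≡ pos
  with t , t∈ , ok ← schurCoeff-pos⁻ μ (a ∷ b ∷ []) pos
  with ssyt , content ← ∧-true⁻ ok
  with t′ , t′-SSYT ← balancedTableau μ n t t∈ ssyt (trans (binaryTableau-size μ t t∈ content) a+b≡)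
  = schurCoeff-pos⁺ μ (n ∷ n ∷ []) t′ t′-SSYT

m*n>0⇒m>0×n>0 : ∀ m n → 0 < m * n → 0 < m × 0 < n
m*n>0⇒m>0×n>0 (suc m) (suc n) _ = s≤s z≤n , s≤s z≤n
m*n>0⇒m>0×n>0 (suc m) zero pos rewrite *-zeroʳ m = ⊥-elim (<-irrefl refl pos)

module _ {A : Set} (f : A → ℕ) where

  sum-map-pos⁻ : ∀ xs → 0 < sum (map f xs) → ∃ λ x → x ∈ xs × 0 < f x
  sum-map-pos⁻ (x ∷ xs) pos with f x in fx
  ... | suc _ = x , here refl , subst (0 <_) (sym fx) (s≤s z≤n)
  ... | zero with y , y∈xs , fy>0 ← sum-map-pos⁻ xs pos = y , there y∈xs , fy>0

  sum-map-pos⁺ : ∀ {x} xs → x ∈ xs → 0 < f x → 0 < sum (map f xs)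
  sum-map-pos⁺ (x ∷ xs) (here refl) fx>0 = <-≤-trans fx>0 (m≤m+n _ _)
  sum-map-pos⁺ (x ∷ xs) (there x∈xs) fx>0 = <-≤-trans (sum-map-pos⁺ xs x∈xs fx>0) (m≤n+m _ _)

-- The coefficient of x₁ᵃ x₂ᵇ in a Schur positive function is a nonnegative combination
-- of two-letter Kostka numbers, and each of those stays positive after balancing (a, b).
schurPositive-balance : ∀ d c {a b} n → SchurPositive d c → a + b ≡ n + n →
                        0 < c (a ∷ b ∷ []) → 0 < c (n ∷ n ∷ [])
schurPositive-balance d c {a} {b} n (coeff , c≡) a+b≡ pos
  with μ , μ∈ , term>0 ← sum-map-pos⁻ (λ μ → coeff μ * schurCoeff μ (a ∷ b ∷ [])) (partitions d)
                                      (subst (0 <_) (c≡ _) pos)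
  with coeff>0 , kostka>0 ← m*n>0⇒m>0×n>0 (coeff μ) _ term>0
  = subst (0 <_) (sym (c≡ _))
      (sum-map-pos⁺ (λ μ → coeff μ * schurCoeff μ (n ∷ n ∷ [])) (partitions d) μ∈
        (*-mono-< coeff>0 (kostka-balance μ n a+b≡ kostka>0)))

-- Chromatic coefficients of two-colour monomials

module _ {A : Set} where

  allB-true⁻ : (p : A → Bool) → ∀ xs → allB p xs ≡ true → ∀ {x} → x ∈ xs → p x ≡ true
  allB-true⁻ p (y ∷ xs) all (here refl) = proj₁ (∧-true⁻ all)
  allB-true⁻ p (y ∷ xs) all (there x∈xs) = allB-true⁻ p xs (proj₂ (∧-true⁻ {p y} all)) x∈xs

  allB-true⁺ : (p : A → Bool) → ∀ xs → (∀ {x} → x ∈ xs → p x ≡ true) → allB p xs ≡ true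
  allB-true⁺ p [] _ = refl
  allB-true⁺ p (y ∷ xs) all = ∧-true⁺ (all (here refl)) (allB-true⁺ p xs (λ x∈xs → all (there x∈xs)))

∈-allFuns : ∀ m k (κ : Fin m → Fin k) → ∃ λ κ′ → κ′ ∈ allFuns m k × (∀ i → κ′ i ≡ κ i)
∈-allFuns zero k κ = _ , here refl , λ ()
∈-allFuns (suc m) k κ with κ′ , κ′∈ , κ′≗κ ← ∈-allFuns m k (λ i → κ (suc i)) =
  (κ zero ∷ᶠ κ′) ,
  ∈-concatMap⁺ (λ c → map (λ f → c ∷ᶠ f) (allFuns m k))
    (lose (∈-allFin (κ zero)) (∈-map⁺ (κ zero ∷ᶠ_) κ′∈)) ,
  λ { zero → refl ; (suc i) → κ′≗κ i }

Proper : ∀ {m k} → Adjacency m → (Fin m → Fin k) → Set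
Proper G κ = ∀ u w → G u w ≡ true → κ u ≢ κ w

classSize : ∀ {m k} → (Fin m → Fin k) → ℕ → ℕ
classSize {m} κ c = countB (λ u → toℕ (κ u) ≡ᵇ c) (allFin m)

module _ {m : ℕ} (G : Adjacency m) where

  properB-true⁻ : ∀ {k} (κ : Fin m → Fin k) → properB G κ ≡ true → Proper G κ
  properB-true⁻ κ ok u w uw κu≡κw
    with allB-true⁻ _ (allFin m) (allB-true⁻ _ (allFin m) ok (∈-allFin u)) (∈-allFin w)
  ... | ok-uw rewrite uw | ≡⇒≡ᵇ-true (cong toℕ κu≡κw) with () ← ok-uw

  properB-true⁺ : ∀ {k} (κ : Fin m → Fin k) → Proper G κ → properB G κ ≡ true
  properB-true⁺ κ proper = allB-true⁺ _ (allFin m) λ {u} _ → allB-true⁺ _ (allFin m) λ {w} _ → edge u w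
    where
    edge : ∀ u w → (not (G u w) ∨ not (toℕ (κ u) ≡ᵇ toℕ (κ w))) ≡ true
    edge u w with G u w in uw
    ... | false = refl
    ... | true rewrite ≢⇒≡ᵇ-false (λ e → proper u w uw (toℕ-injective e)) = refl

  chromCoeff₂-pos⁺ : (κ : Fin m → Fin 2) → Proper G κ →
                     0 < chromCoeff G (classSize κ 0 ∷ classSize κ 1 ∷ [])
  chromCoeff₂-pos⁺ κ proper with κ′ , κ′∈ , κ′≗κ ← ∈-allFuns m 2 κ =
    countB-pos⁺ _ (allFuns m 2) κ′∈
      (∧-true⁺ (properB-true⁺ κ′ (λ u w uw e → proper u w uw (trans (sym (κ′≗κ u)) (trans e (κ′≗κ w)))))
               (∧-true⁺ (≡⇒≡ᵇ-true (sameSize 0)) (∧-true⁺ (≡⇒≡ᵇ-true (sameSize 1)) refl)))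
    where
    sameSize : ∀ c → classSize κ′ c ≡ classSize κ c
    sameSize c = countB-cong _ _ (λ u → cong (λ i → toℕ i ≡ᵇ c) (κ′≗κ u)) (allFin m)

  chromCoeff₂-pos⁻ : ∀ {a b} → 0 < chromCoeff G (a ∷ b ∷ []) →
                     ∃ λ (κ : Fin m → Fin 2) → Proper G κ × classSize κ 0 ≡ a × classSize κ 1 ≡ b
  chromCoeff₂-pos⁻ pos with κ , _ , ok ← countB-pos⁻ _ (allFuns m 2) pos
    with proper , sizes ← ∧-true⁻ ok
    with size₀ , sizes′ ← ∧-true⁻ sizes
    with size₁ , _ ← ∧-true⁻ sizes′
    = κ , properB-true⁻ κ proper , ≡ᵇ-true⇒≡ size₀ , ≡ᵇ-true⇒≡ size₁

classSize₀+classSize₁ : ∀ {m} (κ : Fin m → Fin 2) → classSize κ 0 + classSize κ 1 ≡ m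
classSize₀+classSize₁ {m} κ = begin
  classSize κ 0 + classSize κ 1                         ≡⟨ countB-∨ _ _ disjoint (allFin m) ⟨
  countB (λ u → (toℕ (κ u) ≡ᵇ 0) ∨ (toℕ (κ u) ≡ᵇ 1)) (allFin m) ≡⟨ countB-cong _ _ covers (allFin m) ⟩
  countB (λ _ → true) (allFin m)                        ≡⟨ countB-true (allFin m) ⟩
  length (allFin m)                                     ≡⟨ length-tabulate (λ i → i) ⟩
  m ∎
  where
  open ≡-Reasoning
  disjoint : ∀ u → (toℕ (κ u) ≡ᵇ 0) ≡ true → (toℕ (κ u) ≡ᵇ 1) ≡ false
  disjoint u _ with κ u
  ... | zero = refl
  covers : ∀ u → ((toℕ (κ u) ≡ᵇ 0) ∨ (toℕ (κ u) ≡ᵇ 1)) ≡ true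
  covers u with κ u
  ... | zero = refl
  ... | suc zero = refl

-- Trees are bipartite

parity-suc : ∀ c → parity (suc c) ≡ parity c ⁻¹
parity-suc c = sym (ℙₚ.suc-homo-⁻¹ (suc c))

parity-+suc : ∀ b c → parity (b + suc c) ≡ parity b ℙ.+ parity c ⁻¹
parity-+suc b c = trans (ℙₚ.+-homo-+ b (suc c)) (cong (parity b ℙ.+_) (parity-suc c))

odd+odd⇒even : ∀ b c → parity b ≡ 1ℙ → parity (b + suc c) ≡ 0ℙ → parity c ≡ 0ℙ
odd+odd⇒even b c b-odd sum-even with parity c in pc | trans (sym (parity-+suc b c)) sum-even
... | 0ℙ | _ = refl
... | 1ℙ | e rewrite b-odd with () ← e

same⇒suc-odd : ∀ a b → parity a ≡ parity b → parity (suc (a + b)) ≡ 1ℙ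
same⇒suc-odd a b same rewrite parity-suc (a + b) | ℙₚ.+-homo-+ a b | same with parity b
... | 0ℙ = refl
... | 1ℙ = refl

module _ {A : Set} {R : A → A → Set} where

  Linked-++⁻ : ∀ xs y ys → Linked R (xs ++ y ∷ ys) → Linked R (xs ++ [ y ]) × Linked R (y ∷ ys)
  Linked-++⁻ [] y ys l = [-] , l
  Linked-++⁻ (x ∷ []) y ys (r ∷ l) = r ∷ [-] , l
  Linked-++⁻ (x ∷ x′ ∷ xs) y ys (r ∷ l) with l₁ , l₂ ← Linked-++⁻ (x′ ∷ xs) y ys l = r ∷ l₁ , l₂

  Linked-++⁺ : ∀ xs y ys → Linked R (xs ++ [ y ]) → Linked R (y ∷ ys) → Linked R (xs ++ y ∷ ys)
  Linked-++⁺ [] y ys _ l = l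
  Linked-++⁺ (x ∷ []) y ys (r ∷ _) l = r ∷ l
  Linked-++⁺ (x ∷ x′ ∷ xs) y ys (r ∷ l₁) l = r ∷ Linked-++⁺ (x′ ∷ xs) y ys l₁ l

module _ {m : ℕ} where

  unique⊎repeat : (ys : List (Fin m)) →
                  Unique ys ⊎ ∃ λ A → ∃ λ x → ∃ λ B → ∃ λ C → ys ≡ A ++ x ∷ B ++ x ∷ C
  unique⊎repeat [] = inj₁ []
  unique⊎repeat (y ∷ ys) with any? (y ≟ᶠ_) ys
  ... | yes y∈ys with B , C , eq ← ∈-∃++ y∈ys = inj₂ ([] , y , B , C , cong (y ∷_) eq)
  ... | no y∉ys with unique⊎repeat ys
  ... | inj₁ unique = inj₁ (All.¬Any⇒All¬ ys y∉ys ∷ unique)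
  ... | inj₂ (A , x , B , C , eq) = inj₂ (y ∷ A , x , B , C , cong (y ∷_) eq)

module _ {m : ℕ} {G : Adjacency m} where

  walkLength : ∀ {a b} → Walk G a b → ℕ
  walkLength here = 0
  walkLength (step _ w) = suc (walkLength w)

  _++ʷ_ : ∀ {a b c} → Walk G a b → Walk G b c → Walk G a c
  here ++ʷ w′ = w′
  step e w ++ʷ w′ = step e (w ++ʷ w′)

  walkLength-++ʷ : ∀ {a b c} (w : Walk G a b) (w′ : Walk G b c) →
                   walkLength (w ++ʷ w′) ≡ walkLength w + walkLength w′
  walkLength-++ʷ here w′ = refl
  walkLength-++ʷ (step e w) w′ = cong suc (walkLength-++ʷ w w′)

  -- all vertices of the walk except the last one
  vertices : ∀ {a b} → Walk G a b → List (Fin m)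
  vertices here = []
  vertices (step {u} e w) = u ∷ vertices w

  length-vertices : ∀ {a b} (w : Walk G a b) → length (vertices w) ≡ walkLength w
  length-vertices here = refl
  length-vertices (step e w) = cong suc (length-vertices w)

  Linked-vertices : ∀ {a b} (w : Walk G a b) → Linked (Adj G) (vertices w ∷ʳ b)
  Linked-vertices here = [-]
  Linked-vertices (step e here) = e ∷ [-]
  Linked-vertices (step e (step e′ w)) = e ∷ Linked-vertices (step e′ w)

  firstStep : ∀ {a b} → Walk G a b → a ≢ b → ∃ λ y → G a y ≡ true
  firstStep here a≢b = ⊥-elim (a≢b refl)
  firstStep (step e w) _ = _ , e

  module _ (G-sym : ∀ u w → G u w ≡ G w u) where

    reverseʷ : ∀ {a b} → Walk G a b → Walk G b a
    reverseʷ here = here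
    reverseʷ (step {u} {v} e w) = reverseʷ w ++ʷ step (trans (G-sym v u) e) here

    walkLength-reverseʷ : ∀ {a b} (w : Walk G a b) → walkLength (reverseʷ w) ≡ walkLength w
    walkLength-reverseʷ here = refl
    walkLength-reverseʷ (step e w) =
      trans (walkLength-++ʷ (reverseʷ w) _) (trans (+-comm _ 1) (cong suc (walkLength-reverseʷ w)))

module _ {m : ℕ} {G : Adjacency m} (loopless : ∀ u → G u u ≡ false) (acyclic : Acyclic G) where

  private
    -- h ∷ rest ∷ʳ h is a closed walk of odd length 1 + length rest.
    OddClosed : Fin m → List (Fin m) → Set
    OddClosed h rest = Linked (Adj G) ((h ∷ rest) ∷ʳ h) × parity (length rest) ≡ 0ℙ

    NoOddClosedBelow : ℕ → Set
    NoOddClosedBelow k = ∀ h rest → length rest < k → OddClosed h rest → ⊥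

    noOddCycle : ∀ h rest → Unique (h ∷ rest) → OddClosed h rest → ⊥
    noOddCycle h [] _ (hh ∷ _ , _) with () ← trans (sym (loopless h)) hh
    noOddCycle h (y ∷ []) _ (_ , ())
    noOddCycle h (y ∷ z ∷ rest) unique (linked , _) = acyclic h (y ∷ z ∷ rest) (s≤s (s≤s z≤n) , unique , linked)

    -- An odd closed walk glued from two closed walks has an odd piece.
    oddPiece : ∀ k → NoOddClosedBelow k → ∀ x y B C → length B + suc (length C) ≤ k →
               parity (length B + suc (length C)) ≡ 0ℙ →
               Linked (Adj G) ((x ∷ B) ∷ʳ x) → Linked (Adj G) ((y ∷ C) ∷ʳ y) → ⊥
    oddPiece k ih x y B C len≤ even linkedB linkedC with parity (length B) in B-parity
    ... | 0ℙ = ih x B (<-≤-trans (m<m+n (length B) (s≤s z≤n)) len≤) (linkedB , B-parity)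
    ... | 1ℙ = ih y C (<-≤-trans (<-≤-trans (n<1+n (length C)) (m≤n+m _ (length B))) len≤)
                 (linkedC , odd+odd⇒even (length B) (length C) B-parity even)

    returnToBase : ∀ k h B C → NoOddClosedBelow k → length (B ++ h ∷ C) ≤ k → OddClosed h (B ++ h ∷ C) → ⊥
    returnToBase k h B C ih len≤ (linked , even)
      with linkedB , linkedC ← Linked-++⁻ (h ∷ B) h (C ++ [ h ])
                                 (subst (Linked (Adj G)) (cong (h ∷_) (++-assoc B (h ∷ C) [ h ])) linked)
      = oddPiece k ih h h B C (subst (_≤ k) (length-++ B) len≤) (subst (λ l → parity l ≡ 0ℙ) (length-++ B) even)
                 linkedB linkedC

    length-repeat : ∀ h x (A B C : List (Fin m)) →
                    length (A ++ x ∷ B ++ x ∷ C) ≡ length B + suc (length (C ++ h ∷ A))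
    length-repeat h x A B C rewrite length-++ A {x ∷ B ++ x ∷ C} | length-++ B {x ∷ C} | length-++ C {h ∷ A} =
      solve 3 (λ a b c → a :+ (con 1 :+ (b :+ (con 1 :+ c))) := b :+ (con 1 :+ (c :+ (con 1 :+ a))))
              refl (length A) (length B) (length C)
      where open +-*-Solver

    reassoc : ∀ h (A : List (Fin m)) x B C →
              (h ∷ A ++ x ∷ B ++ x ∷ C) ∷ʳ h ≡ (h ∷ A) ++ x ∷ (B ++ x ∷ (C ++ [ h ]))
    reassoc h A x B C = cong (h ∷_) (trans (++-assoc A (x ∷ B ++ x ∷ C) [ h ])
                                           (cong (λ z → A ++ x ∷ z) (++-assoc B (x ∷ C) [ h ])))

    -- A vertex repeated inside rest cuts the closed walk at that vertex.
    repeatInside : ∀ k h A x B C → NoOddClosedBelow k → let rest = A ++ x ∷ B ++ x ∷ C in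
                   length rest ≤ k → OddClosed h rest → ⊥
    repeatInside k h A x B C ih len≤ (linked , even)
      with linkedA , linkedBC ← Linked-++⁻ (h ∷ A) x (B ++ x ∷ (C ++ [ h ]))
                                  (subst (Linked (Adj G)) (reassoc h A x B C) linked)
      with linkedB , linkedC ← Linked-++⁻ (x ∷ B) x (C ++ [ h ]) linkedBC
      = oddPiece k ih x x B (C ++ h ∷ A) (subst (_≤ k) (length-repeat h x A B C) len≤)
                 (subst (λ l → parity l ≡ 0ℙ) (length-repeat h x A B C) even) linkedB
                 (subst (Linked (Adj G)) (cong (x ∷_) (sym (++-assoc C (h ∷ A) [ x ])))
                   (Linked-++⁺ (x ∷ C) h (A ++ [ x ]) linkedC linkedA))

    noOddClosedBelow : ∀ k → NoOddClosedBelow k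
    noOddClosedBelow (suc k) h rest (s≤s len≤) odd with any? (h ≟ᶠ_) rest
    ... | yes h∈rest with B , C , refl ← ∈-∃++ h∈rest = returnToBase k h B C (noOddClosedBelow k) len≤ odd
    ... | no h∉rest with unique⊎repeat rest
    ... | inj₁ unique = noOddCycle h rest (All.¬Any⇒All¬ rest h∉rest ∷ unique) odd
    ... | inj₂ (A , x , B , C , refl) = repeatInside k h A x B C (noOddClosedBelow k) len≤ odd

  oddClosedWalk⇒⊥ : ∀ {u} (w : Walk G u u) → parity (walkLength w) ≡ 1ℙ → ⊥
  oddClosedWalk⇒⊥ (step {u} e w) odd =
    noOddClosedBelow (suc (length (vertices w))) u (vertices w) ≤-refl
      (Linked-vertices (step e w) , trans (cong parity (length-vertices w)) (even w odd))
    where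
    even : ∀ w′ → parity (suc (walkLength w′)) ≡ 1ℙ → parity (walkLength w′) ≡ 0ℙ
    even w′ p = trans (sym (ℙₚ.suc-homo-⁻¹ (walkLength w′))) (cong _⁻¹ p)

fromParity : Parity → Fin 2
fromParity 0ℙ = zero
fromParity 1ℙ = suc zero

fromParity-injective : ∀ {p q} → fromParity p ≡ fromParity q → p ≡ q
fromParity-injective {0ℙ} {0ℙ} _ = refl
fromParity-injective {1ℙ} {1ℙ} _ = refl

module _ {m : ℕ} {G : Adjacency m} (simple : IsSimple G) (tree : IsTree G) where

  -- Any walk to v will do, since in an acyclic graph all closed walks have even length.
  parityColouring : Fin m → Fin m → Fin 2
  parityColouring v u = fromParity (parity (walkLength (proj₁ tree u v)))

  parityColouring-proper : ∀ v → Proper G (parityColouring v)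
  parityColouring-proper v u w uw same = oddClosedWalk⇒⊥ (proj₂ simple) (proj₂ tree) closed
    (subst (λ l → parity (suc l) ≡ 1ℙ) (sym (walkLength-++ʷ toV fromV))
      (same⇒suc-odd (walkLength toV) (walkLength fromV)
        (trans (sym (fromParity-injective same)) (cong parity (sym (walkLength-reverseʷ (proj₁ simple) (proj₁ tree u v)))))))
    where
    toV = proj₁ tree w v
    fromV = reverseʷ (proj₁ simple) (proj₁ tree u v)
    closed : Walk G u u
    closed = step uw (toV ++ʷ fromV)

-- Balanced 2-colourings force radius two

schurPositive⇒balancedColouring : ∀ {m} {G : Adjacency m} d n → IsSimple G → IsTree G → Fin m → m ≡ n + n →
                                  SchurPositive d (chromCoeff G) →
                                  ∃ λ κ → Proper G κ × classSize κ 0 ≡ n × classSize κ 1 ≡ n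
schurPositive⇒balancedColouring {G = G} d n simple tree v m≡n+n schurPositive =
  chromCoeff₂-pos⁻ G (schurPositive-balance d (chromCoeff G) n schurPositive
                        (trans (classSize₀+classSize₁ κ) m≡n+n)
                        (chromCoeff₂-pos⁺ G κ (parityColouring-proper simple tree v)))
  where
  κ = parityColouring simple tree v

WithinTwo : ∀ {m} → Adjacency m → Fin m → Fin m → Set
WithinTwo G v u = u ≡ v ⊎ G v u ≡ true ⊎ ∃ λ a → G v a ≡ true × G a u ≡ true

module _ {m : ℕ} {G : Adjacency m} (G-sym : ∀ u w → G u w ≡ G w u) (connected : Connected G)
         (v : Fin m) {n : ℕ} (deg : degree G v ≡ n)
         (κ : Fin m → Fin 2) (proper : Proper G κ) (size₀ : classSize κ 0 ≡ n) (size₁ : classSize κ 1 ≡ n)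
         where

  private
    otherColour : Fin m → Bool
    otherColour u = not (toℕ (κ u) ≡ᵇ toℕ (κ v))

    otherClass-size : countB otherColour (allFin m) ≡ n
    otherClass-size with κ v
    ... | zero = trans (countB-cong _ _ flip (allFin m)) size₁
      where
      flip : ∀ u → not (toℕ (κ u) ≡ᵇ 0) ≡ (toℕ (κ u) ≡ᵇ 1)
      flip u with κ u
      ... | zero = refl
      ... | suc zero = refl
    ... | suc zero = trans (countB-cong _ _ flip (allFin m)) size₀
      where
      flip : ∀ u → not (toℕ (κ u) ≡ᵇ 1) ≡ (toℕ (κ u) ≡ᵇ 0)
      flip u with κ u
      ... | zero = refl
      ... | suc zero = refl

    neighbour⇒other : ∀ u → G v u ≡ true → otherColour u ≡ true
    neighbour⇒other u vu rewrite ≢⇒≡ᵇ-false (λ e → proper v u vu (sym (toℕ-injective e))) = refl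

    -- Both sets have n elements, so the inclusion is an equality.
    other⇒neighbour : ∀ u → otherColour u ≡ true → G v u ≡ true
    other⇒neighbour u =
      countB-mono-≡ (G v) otherColour neighbour⇒other (allFin m) (trans deg (sym otherClass-size)) (∈-allFin u)

    sameColour : ∀ u → G v u ≡ false → κ u ≡ κ v
    sameColour u vu with toℕ (κ u) ≡ᵇ toℕ (κ v) in e
    ... | true = toℕ-injective (≡ᵇ-true⇒≡ e)
    ... | false with () ← trans (sym vu) (other⇒neighbour u (cong not e))

  balanced⇒withinTwo : ∀ u → WithinTwo G v u
  balanced⇒withinTwo u with u ≟ᶠ v
  ... | yes u≡v = inj₁ u≡v
  ... | no u≢v with G v u in vu
  ... | true = inj₂ (inj₁ refl)
  ... | false with y , uy ← firstStep (connected u v) u≢v =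
    inj₂ (inj₂ (y , other⇒neighbour y other , trans (G-sym y u) uy))
    where
    other : otherColour y ≡ true
    other rewrite ≢⇒≡ᵇ-false (λ e → proper u y uy (trans (sameColour u vu) (sym (toℕ-injective e)))) = refl

countB-tabulate : ∀ {B : Set} k (f : Fin k → B) (P : B → Bool) →
                  countB P (tabulate f) ≡ countB (λ i → P (f i)) (allFin k)
countB-tabulate zero f P = refl
countB-tabulate (suc k) f P with P (f zero)
... | true = cong suc (trans (countB-tabulate k (λ i → f (suc i)) P) (sym (countB-tabulate k suc (λ i → P (f i)))))
... | false = trans (countB-tabulate k (λ i → f (suc i)) P) (sym (countB-tabulate k suc (λ i → P (f i))))

countB-≡ᵇ-single : ∀ {k} (v : Fin k) → countB (λ u → toℕ u ≡ᵇ toℕ v) (allFin k) ≡ 1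
countB-≡ᵇ-single {suc k} zero = cong suc (trans (countB-tabulate k suc _) (countB-zero _ (λ _ → refl) (allFin k)))
countB-≡ᵇ-single {suc k} (suc v) = trans (countB-tabulate k suc _) (countB-≡ᵇ-single v)

-- Ranking the elements of a finite set

injective⇒surjective : ∀ k (f : Fin k → Fin k) → (∀ x y → f x ≡ f y → x ≡ y) → ∀ y → ∃ λ x → f x ≡ y
injective⇒surjective (suc k) f f-inj y with any?ᶠ (λ x → f x ≟ᶠ y)
... | yes found = found
... | no notFound = ⊥-elim (<-irrefl refl (injective⇒≤ {f = squeeze} squeeze-injective))
  where
  missed : ∀ x → y ≢ f x
  missed x e = notFound (x , sym e)
  squeeze : Fin (suc k) → Fin k
  squeeze x = punchOut (missed x)
  squeeze-injective : ∀ {x z} → squeeze x ≡ squeeze z → x ≡ z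
  squeeze-injective {x} {z} e = f-inj x z (punchOut-injective (missed x) (missed z) e)

module Ranking {M : ℕ} (key : Fin M → ℕ) where

  Before : Fin M → Fin M → Bool
  Before y x = (key y <ᵇ key x) ∨ ((key y ≡ᵇ key x) ∧ (toℕ y <ᵇ toℕ x))

  before-irrefl : ∀ x → Before x x ≡ false
  before-irrefl x rewrite ≮⇒<ᵇ-false (<-irrefl (refl {x = key x})) | ≮⇒<ᵇ-false (<-irrefl (refl {x = toℕ x}))
    = ∧-zeroʳ (key x ≡ᵇ key x)

  before⁻ : ∀ y x → Before y x ≡ true → key y < key x ⊎ (key y ≡ key x × toℕ y < toℕ x)
  before⁻ y x yx with key y <ᵇ key x in lt
  ... | true = inj₁ (<ᵇ-true⇒< lt)
  ... | false with same , earlier ← ∧-true⁻ {key y ≡ᵇ key x} yx = inj₂ (≡ᵇ-true⇒≡ same , <ᵇ-true⇒< earlier)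

  before⁺ˡ : ∀ y x → key y < key x → Before y x ≡ true
  before⁺ˡ y x lt rewrite <⇒<ᵇ-true lt = refl

  before⁺ʳ : ∀ y x → key y ≡ key x → toℕ y < toℕ x → Before y x ≡ true
  before⁺ʳ y x same earlier with key y <ᵇ key x
  ... | true = refl
  ... | false rewrite ≡⇒≡ᵇ-true same | <⇒<ᵇ-true earlier = refl

  before-trans : ∀ x y z → Before x y ≡ true → Before y z ≡ true → Before x z ≡ true
  before-trans x y z xy yz with before⁻ x y xy | before⁻ y z yz
  ... | inj₁ a | inj₁ b = before⁺ˡ x z (<-trans a b)
  ... | inj₁ a | inj₂ (b , _) = before⁺ˡ x z (subst (key x <_) b a)
  ... | inj₂ (a , _) | inj₁ b = before⁺ˡ x z (subst (_< key z) (sym a) b)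
  ... | inj₂ (a , p) | inj₂ (b , q) = before⁺ʳ x z (trans a b) (<-trans p q)

  before-total : ∀ x y → x ≢ y → Before x y ≡ true ⊎ Before y x ≡ true
  before-total x y x≢y with <-cmp (key x) (key y)
  ... | tri< a _ _ = inj₁ (before⁺ˡ x y a)
  ... | tri> _ _ c = inj₂ (before⁺ˡ y x c)
  ... | tri≈ _ b _ with <-cmp (toℕ x) (toℕ y)
  ... | tri< a _ _ = inj₁ (before⁺ʳ x y b a)
  ... | tri≈ _ e _ = ⊥-elim (x≢y (toℕ-injective e))
  ... | tri> _ _ c = inj₂ (before⁺ʳ y x (sym b) c)

  before⇒key≤ : ∀ y x → Before y x ≡ true → key y ≤ key x
  before⇒key≤ y x yx with before⁻ y x yx
  ... | inj₁ lt = <⇒≤ lt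
  ... | inj₂ (same , _) = ≤-reflexive same

  module _ (S : Fin M → Bool) where

    rank : Fin M → ℕ
    rank x = countB (λ y → S y ∧ Before y x) (allFin M)

    private
      notBeforeItself : ∀ x → (S x ∧ Before x x) ≡ false
      notBeforeItself x = trans (cong (S x ∧_) (before-irrefl x)) (∧-zeroʳ (S x))

    rank-mono-< : ∀ x y → S x ≡ true → Before x y ≡ true → rank x < rank y
    rank-mono-< x y sx xy =
      countB-mono-< _ _ earlier (allFin M) (∈-allFin x) (notBeforeItself x) (∧-true⁺ sx xy)
      where
      earlier : ∀ z → (S z ∧ Before z x) ≡ true → (S z ∧ Before z y) ≡ true
      earlier z e with sz , zx ← ∧-true⁻ {S z} e = ∧-true⁺ sz (before-trans z x y zx xy)

    rank-injective : ∀ x y → S x ≡ true → S y ≡ true → rank x ≡ rank y → x ≡ y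
    rank-injective x y sx sy e with x ≟ᶠ y
    ... | yes x≡y = x≡y
    ... | no x≢y with before-total x y x≢y
    ... | inj₁ xy = ⊥-elim (<-irrefl e (rank-mono-< x y sx xy))
    ... | inj₂ yx = ⊥-elim (<-irrefl (sym e) (rank-mono-< y x sy yx))

    rank<⇒before : ∀ x y → S x ≡ true → S y ≡ true → rank x < rank y → Before x y ≡ true
    rank<⇒before x y sx sy lt with x ≟ᶠ y
    ... | yes refl = ⊥-elim (<-irrefl refl lt)
    ... | no x≢y with before-total x y x≢y
    ... | inj₁ xy = xy
    ... | inj₂ yx = ⊥-elim (<-asym lt (rank-mono-< y x sy yx))

    rank<size : ∀ x → S x ≡ true → rank x < countB S (allFin M)
    rank<size x sx = countB-mono-< _ _ (λ z e → proj₁ (∧-true⁻ {S z} e)) (allFin M) (∈-allFin x) (notBeforeItself x) sx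

-- Trees of radius two are of the form T(ν)

2*n≡n+n : ∀ n → 2 * n ≡ n + n
2*n≡n+n n = cong (n +_) (+-identityʳ n)

module RadiusTwo (n : ℕ) (n≥1 : 1 ≤ n) {G : Adjacency (2 * n)} (simple : IsSimple G) (acyclic : Acyclic G)
                 (v : Fin (2 * n)) (deg : degree G v ≡ n) (withinTwo : ∀ u → WithinTwo G v u) where

  M : ℕ
  M = 2 * n

  M≡n+n : M ≡ n + n
  M≡n+n = 2*n≡n+n n

  G-sym : ∀ {u w} → G u w ≡ true → G w u ≡ true
  G-sym {u} {w} uw = trans (proj₁ simple w u) uw

  adjacent⇒≢ : ∀ {u w} → G u w ≡ true → u ≢ w
  adjacent⇒≢ {u} uw refl with () ← trans (sym (proj₂ simple u)) uw

  isCentre : Fin M → Bool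
  isCentre u = toℕ u ≡ᵇ toℕ v

  isOuter : Fin M → Bool
  isOuter u = not (isCentre u) ∧ not (G v u)

  isOuter⁺ : ∀ {u} → u ≢ v → G v u ≡ false → isOuter u ≡ true
  isOuter⁺ u≢v vu rewrite ≢⇒≡ᵇ-false (λ e → u≢v (toℕ-injective e)) | vu = refl

  isOuter⁻ : ∀ {u} → isOuter u ≡ true → u ≢ v × G v u ≡ false
  isOuter⁻ {u} u-outer with notCentre , notInner ← ∧-true⁻ {not (isCentre u)} u-outer =
    (λ { refl → centre (not-true⁻ notCentre) }) , not-true⁻ notInner
    where
    centre : isCentre v ≡ false → ⊥
    centre e with () ← trans (sym e) (≡⇒≡ᵇ-true {toℕ v} refl)

  data Position (u : Fin M) : Set where
    centre : u ≡ v → Position u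
    inner : G v u ≡ true → Position u
    outer : isOuter u ≡ true → Position u

  position : ∀ u → Position u
  position u with u ≟ᶠ v
  ... | yes u≡v = centre u≡v
  ... | no u≢v with G v u in vu
  ... | true = inner vu
  ... | false = outer (isOuter⁺ u≢v vu)

  parent : Fin M → Fin M
  parent u with any?ᶠ (λ a → (G v a ∧ G a u) ≟ᴮ true)
  ... | yes (a , _) = a
  ... | no _ = v

  parent-adjacent : ∀ u → isOuter u ≡ true → G v (parent u) ≡ true × G (parent u) u ≡ true
  parent-adjacent u u-outer with isOuter⁻ u-outer | withinTwo u
  ... | u≢v , _ | inj₁ u≡v = ⊥-elim (u≢v u≡v)
  ... | _ , notInner | inj₂ (inj₁ vu) with () ← trans (sym notInner) vu
  ... | _ , _ | inj₂ (inj₂ (a , va , au)) with any?ᶠ (λ a → (G v a ∧ G a u) ≟ᴮ true)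
  ... | yes (_ , ok) = ∧-true⁻ ok
  ... | no none = ⊥-elim (none (a , ∧-true⁺ va au))

  parent-inner : ∀ u → isOuter u ≡ true → G v (parent u) ≡ true
  parent-inner u u-outer = proj₁ (parent-adjacent u u-outer)

  inner-inner-nonadjacent : ∀ {a b} → G v a ≡ true → G v b ≡ true → G a b ≡ true → ⊥
  inner-inner-nonadjacent va vb ab = acyclic v (_ ∷ _ ∷ [])
    (s≤s (s≤s z≤n) ,
     ((adjacent⇒≢ va ∷ adjacent⇒≢ vb ∷ []) ∷ (adjacent⇒≢ ab ∷ []) ∷ [] ∷ []) ,
     (va ∷ ab ∷ G-sym vb ∷ [-]))

  parent-unique : ∀ {a b u} → G v a ≡ true → G v b ≡ true → G a u ≡ true → G b u ≡ true → isOuter u ≡ true →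
                  a ≡ b
  parent-unique {a} {b} va vb au bu u-outer with a ≟ᶠ b
  ... | yes a≡b = a≡b
  ... | no a≢b = ⊥-elim (acyclic v (a ∷ _ ∷ b ∷ [])
    (s≤s (s≤s z≤n) ,
     ((adjacent⇒≢ va ∷ (λ e → proj₁ (isOuter⁻ u-outer) (sym e)) ∷ adjacent⇒≢ vb ∷ []) ∷
      (adjacent⇒≢ au ∷ a≢b ∷ []) ∷ ((λ e → adjacent⇒≢ bu (sym e)) ∷ []) ∷ [] ∷ []) ,
     (va ∷ au ∷ G-sym bu ∷ G-sym vb ∷ [-])))

  outer-outer-nonadjacent : ∀ {u w} → isOuter u ≡ true → isOuter w ≡ true → G u w ≡ true → ⊥
  outer-outer-nonadjacent {u} {w} u-outer w-outer uw
    with parent-adjacent u u-outer | parent-adjacent w w-outer | parent u ≟ᶠ parent w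
  ... | _ , au | _ , bw | yes a≡b =
    let aw = subst (λ z → G z w ≡ true) (sym a≡b) bw in
    acyclic (parent u) (u ∷ w ∷ [])
      (s≤s (s≤s z≤n) , ((adjacent⇒≢ au ∷ adjacent⇒≢ aw ∷ []) ∷ (adjacent⇒≢ uw ∷ []) ∷ [] ∷ []) ,
       (au ∷ uw ∷ G-sym aw ∷ [-]))
  ... | va , au | vb , bw | no a≢b =
    acyclic v (parent u ∷ u ∷ w ∷ parent w ∷ [])
      (s≤s (s≤s z≤n) ,
       ((adjacent⇒≢ va ∷ (λ e → u≢v (sym e)) ∷ (λ e → w≢v (sym e)) ∷ adjacent⇒≢ vb ∷ []) ∷
        (adjacent⇒≢ au ∷ (λ { refl → w-notInner va }) ∷ a≢b ∷ []) ∷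
        (adjacent⇒≢ uw ∷ (λ { refl → u-notInner vb }) ∷ []) ∷
        ((λ e → adjacent⇒≢ bw (sym e)) ∷ []) ∷ [] ∷ []) ,
       (va ∷ au ∷ uw ∷ G-sym bw ∷ G-sym vb ∷ [-]))
    where
    u≢v = proj₁ (isOuter⁻ u-outer)
    w≢v = proj₁ (isOuter⁻ w-outer)
    u-notInner : G v u ≡ true → ⊥
    u-notInner e with () ← trans (sym (proj₂ (isOuter⁻ u-outer))) e
    w-notInner : G v w ≡ true → ⊥
    w-notInner e with () ← trans (sym (proj₂ (isOuter⁻ w-outer))) e

  children : Fin M → ℕ
  children a = countB (λ ℓ → isOuter ℓ ∧ (toℕ (parent ℓ) ≡ᵇ toℕ a)) (allFin M)

  children≤M : ∀ a → children a ≤ M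
  children≤M a = subst (children a ≤_) (length-tabulate (λ i → i)) (countB≤length _ (allFin M))

  -- Inner vertices are ranked by decreasing number of children.
  module Inner = Ranking (λ a → M ∸ children a)

  innerRank : Fin M → ℕ
  innerRank = Inner.rank (G v)

  module Outer = Ranking (λ ℓ → innerRank (parent ℓ))

  outerRank : Fin M → ℕ
  outerRank = Outer.rank isOuter

  outerCount≡n∸1 : countB isOuter (allFin M) ≡ n ∸ 1
  outerCount≡n∸1 = +-cancelˡ-≡ n _ _ (suc-injective (begin
    suc (n + countB isOuter (allFin M))
      ≡⟨ cong₂ (λ c d → c + (d + countB isOuter (allFin M))) (countB-≡ᵇ-single v) deg ⟨
    countB isCentre (allFin M) + (countB (G v) (allFin M) + countB isOuter (allFin M))
      ≡⟨ cong (countB isCentre (allFin M) +_) (countB-∨ (G v) isOuter inner⇒notOuter (allFin M)) ⟨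
    countB isCentre (allFin M) + countB (λ u → G v u ∨ isOuter u) (allFin M)
      ≡⟨ countB-∨ isCentre _ centre⇒notOther (allFin M) ⟨
    countB (λ u → isCentre u ∨ (G v u ∨ isOuter u)) (allFin M)
      ≡⟨ countB-cong _ _ covers (allFin M) ⟩
    countB (λ _ → true) (allFin M)
      ≡⟨ trans (countB-true (allFin M)) (length-tabulate (λ i → i)) ⟩
    M
      ≡⟨ M≡n+n ⟩
    n + n
      ≡⟨ cong (n +_) (m+[n∸m]≡n n≥1) ⟨
    n + suc (n ∸ 1)
      ≡⟨ +-suc n (n ∸ 1) ⟩
    suc (n + (n ∸ 1)) ∎))
    where
    open ≡-Reasoning
    inner⇒notOuter : ∀ u → G v u ≡ true → isOuter u ≡ false
    inner⇒notOuter u vu rewrite vu = ∧-zeroʳ (not (isCentre u))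
    centre⇒notOther : ∀ u → isCentre u ≡ true → (G v u ∨ isOuter u) ≡ false
    centre⇒notOther u e with refl ← toℕ-injective {i = u} {j = v} (≡ᵇ-true⇒≡ e) rewrite e | proj₂ simple u = refl
    covers : ∀ u → (isCentre u ∨ (G v u ∨ isOuter u)) ≡ true
    covers u with isCentre u | G v u
    ... | true | _ = refl
    ... | false | true = refl
    ... | false | false = refl

  -- As in T(ν): the centre gets label 0, inner vertices 1 … n and outer vertices n+1 … 2n−1,
  -- each class in rank order.
  label : Fin M → ℕ
  label u = if isCentre u then 0 else (if G v u then suc (innerRank u) else suc (n + outerRank u))

  label-centre : label v ≡ 0
  label-centre rewrite ≡⇒≡ᵇ-true {toℕ v} refl = refl

  label-inner : ∀ {u} → G v u ≡ true → label u ≡ suc (innerRank u)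
  label-inner {u} vu rewrite ≢⇒≡ᵇ-false (λ e → adjacent⇒≢ vu (sym (toℕ-injective e))) | vu = refl

  label-outer : ∀ {u} → isOuter u ≡ true → label u ≡ suc (n + outerRank u)
  label-outer {u} u-outer with u≢v , notInner ← isOuter⁻ u-outer
    rewrite ≢⇒≡ᵇ-false (λ e → u≢v (toℕ-injective e)) | notInner = refl

  innerRank<n : ∀ {u} → G v u ≡ true → innerRank u < n
  innerRank<n {u} vu = subst (innerRank u <_) deg (Inner.rank<size (G v) u vu)

  outerRank<n∸1 : ∀ {u} → isOuter u ≡ true → outerRank u < n ∸ 1
  outerRank<n∸1 {u} u-outer = subst (outerRank u <_) outerCount≡n∸1 (Outer.rank<size isOuter u u-outer)

  suc<M : ∀ {k} → k < n → suc k < M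
  suc<M {k} k<n = subst (suc k <_) (sym M≡n+n) (≤-trans (s≤s k<n) (subst (_≤ n + n) (+-comm n 1) (+-monoʳ-≤ n n≥1)))

  suc-n+<M : ∀ {r} → r < n ∸ 1 → suc (n + r) < M
  suc-n+<M {r} r<n∸1 = subst (suc (n + r) <_) (sym M≡n+n)
    (≤-trans (s≤s (+-monoʳ-< n r<n∸1)) (≤-reflexive (trans (sym (+-suc n (n ∸ 1))) (cong (n +_) (m+[n∸m]≡n n≥1)))))

  label<M : ∀ u → label u < M
  label<M u with position u
  ... | centre refl = subst (_< M) (sym label-centre) (<-trans (s≤s z≤n) (suc<M {0} n≥1))
  ... | inner vu = subst (_< M) (sym (label-inner vu)) (suc<M (innerRank<n vu))
  ... | outer u-outer = subst (_< M) (sym (label-outer u-outer)) (suc-n+<M (outerRank<n∸1 u-outer))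

  inner-label≢outer-label : ∀ {a ℓ} → G v a ≡ true → isOuter ℓ ≡ true → label a ≢ label ℓ
  inner-label≢outer-label {a} {ℓ} va ℓ-outer e =
    <-irrefl refl (<-≤-trans (innerRank<n va)
      (subst (n ≤_) (sym (suc-injective (trans (sym (label-inner va)) (trans e (label-outer ℓ-outer))))) (m≤m+n n _)))

  label-injective : ∀ u w → label u ≡ label w → u ≡ w
  label-injective u w e with position u | position w
  ... | centre refl | centre refl = refl
  ... | centre refl | inner vw with () ← trans (sym label-centre) (trans e (label-inner vw))
  ... | centre refl | outer w-outer with () ← trans (sym label-centre) (trans e (label-outer w-outer))
  ... | inner vu | centre refl with () ← trans (sym (label-inner vu)) (trans e label-centre)
  ... | outer u-outer | centre refl with () ← trans (sym (label-outer u-outer)) (trans e label-centre)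
  ... | inner vu | inner vw =
    Inner.rank-injective (G v) u w vu vw (suc-injective (trans (sym (label-inner vu)) (trans e (label-inner vw))))
  ... | inner vu | outer w-outer = ⊥-elim (inner-label≢outer-label vu w-outer e)
  ... | outer u-outer | inner vw = ⊥-elim (inner-label≢outer-label vw u-outer (sym e))
  ... | outer u-outer | outer w-outer = Outer.rank-injective isOuter u w u-outer w-outer
    (+-cancelˡ-≡ n _ _ (suc-injective (trans (sym (label-outer u-outer)) (trans e (label-outer w-outer)))))

  relabel : Fin M → Fin M
  relabel u = fromℕ< (label<M u)

  toℕ-relabel : ∀ u → toℕ (relabel u) ≡ label u
  toℕ-relabel u = toℕ-fromℕ< (label<M u)

  relabel-injective : ∀ u w → relabel u ≡ relabel w → u ≡ w
  relabel-injective u w e = label-injective u w (trans (sym (toℕ-relabel u)) (trans (cong toℕ e) (toℕ-relabel w)))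

  relabel-surjective : ∀ y → ∃ λ u → relabel u ≡ y
  relabel-surjective = injective⇒surjective M relabel relabel-injective

  innerOfRank : ∀ k → k < n → ∃ λ a → G v a ≡ true × innerRank a ≡ k
  innerOfRank k k<n with u , e ← relabel-surjective (fromℕ< (suc<M k<n)) = fromPosition (position u)
    where
    label≡ : label u ≡ suc k
    label≡ = trans (sym (toℕ-relabel u)) (trans (cong toℕ e) (toℕ-fromℕ< (suc<M k<n)))
    fromPosition : Position u → ∃ λ a → G v a ≡ true × innerRank a ≡ k
    fromPosition (centre refl) with () ← trans (sym label-centre) label≡
    fromPosition (inner vu) = u , vu , suc-injective (trans (sym (label-inner vu)) label≡)
    fromPosition (outer u-outer) = ⊥-elim (<-irrefl refl (<-≤-trans k<n
      (subst (n ≤_) (suc-injective (trans (sym (label-outer u-outer)) label≡)) (m≤m+n n _))))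

  parentRank : Fin M → ℕ
  parentRank ℓ = innerRank (parent ℓ)

  νAt : ℕ → ℕ
  νAt k = countB (λ ℓ → isOuter ℓ ∧ (parentRank ℓ ≡ᵇ k)) (allFin M)

  νFrom : ℕ → ℕ → List ℕ
  νFrom s zero = []
  νFrom s (suc t) = νAt s ∷ νFrom (suc s) t

  inRange : ℕ → ℕ → ℕ → Bool
  inRange s d y = (s ≤ᵇ y) ∧ (y <ᵇ s + d)

  νRange : ℕ → ℕ → ℕ
  νRange s d = countB (λ ℓ → isOuter ℓ ∧ inRange s d (parentRank ℓ)) (allFin M)

  inRange-suc : ∀ s d y → inRange s (suc d) y ≡ ((y ≡ᵇ s) ∨ inRange (suc s) d y)
  inRange-suc s d y = true⇔true⇒≡ to from
    where
    to : inRange s (suc d) y ≡ true → ((y ≡ᵇ s) ∨ inRange (suc s) d y) ≡ true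
    to e with s≤y , y< ← ∧-true⁻ {s ≤ᵇ y} e with y ≟ s
    ... | yes y≡s = ∨-true⁺ˡ (≡⇒≡ᵇ-true y≡s)
    ... | no y≢s =
      ∨-true⁺ʳ (∧-true⁺ (≤⇒≤ᵇ-true {suc s} (≤∧≢⇒< (≤ᵇ-true⇒≤ s≤y) (λ e′ → y≢s (sym e′))))
                                    (<⇒<ᵇ-true (subst (y <_) (+-suc s d) (<ᵇ-true⇒< y<))))
    from : ((y ≡ᵇ s) ∨ inRange (suc s) d y) ≡ true → inRange s (suc d) y ≡ true
    from e with ∨-true⁻ e
    ... | inj₁ y≡s with refl ← ≡ᵇ-true⇒≡ {y} {s} y≡s =
      ∧-true⁺ (≤⇒≤ᵇ-true (≤-refl {y})) (<⇒<ᵇ-true (subst (y <_) (sym (+-suc y d)) (s≤s (m≤m+n y d))))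
    ... | inj₂ r with s<y , y< ← ∧-true⁻ {suc s ≤ᵇ y} r =
      ∧-true⁺ (≤⇒≤ᵇ-true (<⇒≤ (≤ᵇ-true⇒≤ {suc s} s<y)))
              (<⇒<ᵇ-true (subst (y <_) (sym (+-suc s d)) (<ᵇ-true⇒< y<)))

  νRange-zero : ∀ s → νRange s 0 ≡ 0
  νRange-zero s = countB-zero _ (λ ℓ → empty (isOuter ℓ) (parentRank ℓ)) (allFin M)
    where
    empty : ∀ b y → (b ∧ inRange s 0 y) ≡ false
    empty false y = refl
    empty true y with s ≤ᵇ y in s≤y
    ... | false = refl
    ... | true =
      ≮⇒<ᵇ-false (λ lt → <-irrefl refl (<-≤-trans lt (subst (_≤ y) (sym (+-identityʳ s)) (≤ᵇ-true⇒≤ s≤y))))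

  νRange-suc : ∀ s d → νRange s (suc d) ≡ νAt s + νRange (suc s) d
  νRange-suc s d =
    trans (countB-cong _ _ (λ ℓ → trans (cong (isOuter ℓ ∧_) (inRange-suc s d (parentRank ℓ)))
                                         (∧-distribˡ-∨ (isOuter ℓ) _ _)) (allFin M))
          (countB-∨ _ _ disjoint (allFin M))
    where
    disjoint : ∀ ℓ → (isOuter ℓ ∧ (parentRank ℓ ≡ᵇ s)) ≡ true →
               (isOuter ℓ ∧ inRange (suc s) d (parentRank ℓ)) ≡ false
    disjoint ℓ e with refl ← ≡ᵇ-true⇒≡ {parentRank ℓ} {s} (proj₂ (∧-true⁻ {isOuter ℓ} e))
      rewrite ≮⇒<ᵇ-false (<-irrefl (refl {x = parentRank ℓ})) = ∧-zeroʳ (isOuter ℓ)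

  sum-νFrom : ∀ s t → sum (νFrom s t) ≡ νRange s t
  sum-νFrom s zero = sym (νRange-zero s)
  sum-νFrom s (suc t) = trans (cong (νAt s +_) (sum-νFrom (suc s) t)) (sym (νRange-suc s t))

  -- νFrom s t lists ν(s), …, ν(s+t−1); the positions νRange s d + r with r < ν(s+d) form block d.
  owner-νFrom : ∀ d s t → d < t → ∀ r → r < νAt (s + d) → owner (νFrom s t) (νRange s d + r) ≡ d
  owner-νFrom zero s (suc t) _ r lt rewrite νRange-zero s | +-identityʳ s | <⇒<ᵇ-true lt = refl
  owner-νFrom (suc d) s (suc t) (s≤s d<t) r lt
    rewrite νRange-suc s d | +-assoc (νAt s) (νRange (suc s) d) r
          | ≮⇒<ᵇ-false {νAt s + (νRange (suc s) d + r)} {νAt s} (λ q → <-irrefl refl (<-≤-trans q (m≤m+n _ _)))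
          | m+n∸m≡n (νAt s) (νRange (suc s) d + r)
    = cong suc (owner-νFrom d (suc s) t d<t r (subst (λ z → r < νAt z) (+-suc s d) lt))

  parentCount : ℕ
  parentCount = countB (λ a → G v a ∧ (0 <ᵇ children a)) (allFin M)

  ν : List ℕ
  ν = νFrom 0 parentCount

  later⇒fewerChildren : ∀ a b → M ∸ children b ≤ M ∸ children a → children a ≤ children b
  later⇒fewerChildren a b le with children a ≤? children b
  ... | yes ≤ = ≤
  ... | no ≰ = ⊥-elim (<-irrefl refl (<-≤-trans (∸-monoʳ-< (≰⇒> ≰) (children≤M a)) le))

  children-parent>0 : ∀ ℓ → isOuter ℓ ≡ true → 0 < children (parent ℓ)
  children-parent>0 ℓ ℓ-outer =
    countB-pos⁺ _ (allFin M) (∈-allFin ℓ) (∧-true⁺ ℓ-outer (≡⇒≡ᵇ-true {toℕ (parent ℓ)} refl))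

  innerRank<parentCount : ∀ a → G v a ≡ true → 0 < children a → innerRank a < parentCount
  innerRank<parentCount a va a-parent =
    countB-mono-< _ _ before⇒parent (allFin M) (∈-allFin a)
      (trans (cong (G v a ∧_) (Inner.before-irrefl a)) (∧-zeroʳ (G v a))) (∧-true⁺ va (<⇒<ᵇ-true a-parent))
    where
    before⇒parent : ∀ b → (G v b ∧ Inner.Before b a) ≡ true → (G v b ∧ (0 <ᵇ children b)) ≡ true
    before⇒parent b e with vb , ba ← ∧-true⁻ {G v b} e =
      ∧-true⁺ vb (<⇒<ᵇ-true (<-≤-trans a-parent (later⇒fewerChildren a b (Inner.before⇒key≤ b a ba))))

  parentRank<parentCount : ∀ ℓ → isOuter ℓ ≡ true → parentRank ℓ < parentCount
  parentRank<parentCount ℓ ℓ-outer =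
    innerRank<parentCount (parent ℓ) (parent-inner ℓ ℓ-outer) (children-parent>0 ℓ ℓ-outer)

  sum-ν : sum ν ≡ n ∸ 1
  sum-ν = trans (sum-νFrom 0 parentCount) (trans (countB-cong _ _ inRange-all (allFin M)) outerCount≡n∸1)
    where
    inRange-all : ∀ ℓ → (isOuter ℓ ∧ inRange 0 parentCount (parentRank ℓ)) ≡ isOuter ℓ
    inRange-all ℓ with isOuter ℓ in ℓ-outer
    ... | false = refl
    ... | true = <⇒<ᵇ-true (parentRank<parentCount ℓ ℓ-outer)

  νAt≡children : ∀ k a → G v a ≡ true → innerRank a ≡ k → νAt k ≡ children a
  νAt≡children k a va rank≡k = countB-cong _ _ sameParent (allFin M)
    where
    sameParent : ∀ ℓ → (isOuter ℓ ∧ (parentRank ℓ ≡ᵇ k)) ≡ (isOuter ℓ ∧ (toℕ (parent ℓ) ≡ᵇ toℕ a))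
    sameParent ℓ with isOuter ℓ in ℓ-outer
    ... | false = refl
    ... | true = true⇔true⇒≡
      (λ e → ≡⇒≡ᵇ-true (cong toℕ (Inner.rank-injective (G v) (parent ℓ) a (parent-inner ℓ ℓ-outer) va
                                                           (trans (≡ᵇ-true⇒≡ e) (sym rank≡k)))))
      (λ e → ≡⇒≡ᵇ-true (trans (cong innerRank (toℕ-injective (≡ᵇ-true⇒≡ e))) rank≡k))

  children>0 : ∀ a → G v a ≡ true → innerRank a < parentCount → 0 < children a
  children>0 a va lt with 0 <? children a
  ... | yes pos = pos
  ... | no ¬pos = ⊥-elim (<-irrefl refl (<-≤-trans lt (countB-mono _ _ parent⇒before (allFin M))))
    where
    parent⇒before : ∀ b → (G v b ∧ (0 <ᵇ children b)) ≡ true → (G v b ∧ Inner.Before b a) ≡ true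
    parent⇒before b e with vb , b-parent ← ∧-true⁻ {G v b} e =
      ∧-true⁺ vb (Inner.before⁺ˡ b a (subst (λ z → M ∸ children b < M ∸ z) (sym (n≤0⇒n≡0 (≮⇒≥ ¬pos)))
                                     (∸-monoʳ-< (<ᵇ-true⇒< b-parent) (children≤M b))))

  parentCount≤n : parentCount ≤ n
  parentCount≤n = subst (parentCount ≤_) deg (countB-mono _ (G v) (λ b e → proj₁ (∧-true⁻ {G v b} e)) (allFin M))

  νAt-positive : ∀ k → k < parentCount → 1 ≤ νAt k
  νAt-positive k k<t with a , va , rank≡k ← innerOfRank k (<-≤-trans k<t parentCount≤n)
    rewrite νAt≡children k a va rank≡k = children>0 a va (subst (_< parentCount) (sym rank≡k) k<t)

  νAt-decreasing : ∀ k → suc k < parentCount → νAt (suc k) ≤ νAt k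
  νAt-decreasing k lt with a , va , rank-a ← innerOfRank k (<-≤-trans (<-trans (n<1+n k) lt) parentCount≤n)
                         | b , vb , rank-b ← innerOfRank (suc k) (<-≤-trans lt parentCount≤n)
    rewrite νAt≡children k a va rank-a | νAt≡children (suc k) b vb rank-b =
    later⇒fewerChildren b a
      (Inner.before⇒key≤ a b (Inner.rank<⇒before (G v) a b va vb (subst₂ _<_ (sym rank-a) (sym rank-b) (n<1+n k))))

  All-νFrom : ∀ s t → (∀ i → s ≤ i → i < s + t → 1 ≤ νAt i) → All (1 ≤_) (νFrom s t)
  All-νFrom s zero _ = []
  All-νFrom s (suc t) pos =
    pos s ≤-refl (subst (s <_) (sym (+-suc s t)) (s≤s (m≤m+n s t)))
    ∷ All-νFrom (suc s) t (λ i s<i i< → pos i (<⇒≤ s<i) (subst (i <_) (sym (+-suc s t)) i<))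

  Linked-νFrom : ∀ s t → (∀ i → s ≤ i → suc i < s + t → νAt (suc i) ≤ νAt i) →
                 Linked (λ a b → b ≤ a) (νFrom s t)
  Linked-νFrom s zero _ = []
  Linked-νFrom s (suc zero) _ = [-]
  Linked-νFrom s (suc (suc t)) decr =
    decr s ≤-refl (subst (suc s <_) (sym (+-suc s (suc t))) (s≤s (subst (suc s ≤_) (sym (+-suc s t)) (s≤s (m≤m+n s t)))))
    ∷ Linked-νFrom (suc s) (suc t) (λ i s<i i< → decr i (<⇒≤ s<i) (subst (suc i <_) (sym (+-suc s (suc t))) i<))

  ν-partition : IsPartition (n ∸ 1) ν
  ν-partition = All-νFrom 0 parentCount (λ i _ → νAt-positive i) ,
                Linked-νFrom 0 parentCount (λ i _ → νAt-decreasing i) ,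
                sum-ν

  siblingsBefore : Fin M → ℕ
  siblingsBefore u = countB (λ y → isOuter y ∧ ((parentRank y ≡ᵇ parentRank u) ∧ (toℕ y <ᵇ toℕ u))) (allFin M)

  outerRank≡ : ∀ u → outerRank u ≡ νRange 0 (parentRank u) + siblingsBefore u
  outerRank≡ u =
    trans (countB-cong _ _ (λ y → ∧-distribˡ-∨ (isOuter y) _ _) (allFin M)) (countB-∨ _ _ disjoint (allFin M))
    where
    disjoint : ∀ y → (isOuter y ∧ (parentRank y <ᵇ parentRank u)) ≡ true →
               (isOuter y ∧ ((parentRank y ≡ᵇ parentRank u) ∧ (toℕ y <ᵇ toℕ u))) ≡ false
    disjoint y e with isOuter y
    ... | true rewrite ≢⇒≡ᵇ-false {parentRank y} {parentRank u} (λ q → <-irrefl q (<ᵇ-true⇒< e)) = refl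

  siblingsBefore<νAt : ∀ u → isOuter u ≡ true → siblingsBefore u < νAt (parentRank u)
  siblingsBefore<νAt u u-outer = countB-mono-< _ _ sibling (allFin M) (∈-allFin u) notBeforeItself itself
    where
    sibling : ∀ y → (isOuter y ∧ ((parentRank y ≡ᵇ parentRank u) ∧ (toℕ y <ᵇ toℕ u))) ≡ true →
              (isOuter y ∧ (parentRank y ≡ᵇ parentRank u)) ≡ true
    sibling y e with y-outer , same ← ∧-true⁻ {isOuter y} e = ∧-true⁺ y-outer (proj₁ (∧-true⁻ same))
    notBeforeItself : (isOuter u ∧ ((parentRank u ≡ᵇ parentRank u) ∧ (toℕ u <ᵇ toℕ u))) ≡ false
    notBeforeItself rewrite ≮⇒<ᵇ-false (<-irrefl (refl {x = toℕ u})) | ∧-zeroʳ (parentRank u ≡ᵇ parentRank u) =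
      ∧-zeroʳ (isOuter u)
    itself : (isOuter u ∧ (parentRank u ≡ᵇ parentRank u)) ≡ true
    itself = ∧-true⁺ u-outer (≡⇒≡ᵇ-true {parentRank u} refl)

  owner-outerRank : ∀ u → isOuter u ≡ true → owner ν (outerRank u) ≡ parentRank u
  owner-outerRank u u-outer rewrite outerRank≡ u =
    owner-νFrom (parentRank u) 0 parentCount (parentRank<parentCount u u-outer) (siblingsBefore u) (siblingsBefore<νAt u u-outer)

  parentT-centre : parentT n ν (label v) ≡ nothing
  parentT-centre rewrite label-centre = refl

  parentT-inner : ∀ {u} → G v u ≡ true → parentT n ν (label u) ≡ just 0
  parentT-inner vu rewrite label-inner vu | <⇒<ᵇ-true (innerRank<n vu) = refl

  parentT-outer : ∀ {u} → isOuter u ≡ true → parentT n ν (label u) ≡ just (label (parent u))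
  parentT-outer {u} u-outer
    rewrite label-outer u-outer
          | ≮⇒<ᵇ-false {n + outerRank u} {n} (λ q → <-irrefl refl (<-≤-trans q (m≤m+n n _)))
          | m+n∸m≡n n (outerRank u) | owner-outerRank u u-outer | label-inner (parent-inner u u-outer) = refl

  isParentB-just : ∀ i j p → parentT n ν i ≡ just p → isParentB n ν i j ≡ (p ≡ᵇ j)
  isParentB-just i j p e with parentT n ν i
  isParentB-just i j p refl | just .p = refl

  isParentB-nothing : ∀ i j → parentT n ν i ≡ nothing → isParentB n ν i j ≡ false
  isParentB-nothing i j e with parentT n ν i
  isParentB-nothing i j refl | nothing = refl

  IsParent : Fin M → Fin M → Set
  IsParent u w = (G v u ≡ true × w ≡ v) ⊎ (isOuter u ≡ true × w ≡ parent u)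

  isParentB⇒IsParent : ∀ u w → isParentB n ν (label u) (label w) ≡ true → IsParent u w
  isParentB⇒IsParent u w e with position u
  ... | centre refl with () ← trans (sym e) (isParentB-nothing (label v) (label w) parentT-centre)
  ... | inner vu = inj₁ (vu , label-injective w v
    (trans (sym (≡ᵇ-true⇒≡ (trans (sym (isParentB-just (label u) (label w) 0 (parentT-inner vu))) e))) (sym label-centre)))
  ... | outer u-outer = inj₂ (u-outer , label-injective w (parent u)
    (sym (≡ᵇ-true⇒≡ (trans (sym (isParentB-just (label u) (label w) _ (parentT-outer u-outer))) e))))

  IsParent⇒isParentB : ∀ u w → IsParent u w → isParentB n ν (label u) (label w) ≡ true
  IsParent⇒isParentB u w (inj₁ (vu , refl)) =
    trans (isParentB-just (label u) (label v) 0 (parentT-inner vu)) (≡⇒≡ᵇ-true (sym label-centre))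
  IsParent⇒isParentB u w (inj₂ (u-outer , refl)) =
    trans (isParentB-just (label u) (label (parent u)) _ (parentT-outer u-outer)) (≡⇒≡ᵇ-true {label (parent u)} refl)

  IsParent⇒adjacent : ∀ u w → IsParent u w → G u w ≡ true
  IsParent⇒adjacent u w (inj₁ (vu , refl)) = G-sym vu
  IsParent⇒adjacent u w (inj₂ (u-outer , refl)) = G-sym (proj₂ (parent-adjacent u u-outer))

  adjacent⇒IsParent : ∀ u w → G u w ≡ true → IsParent u w ⊎ IsParent w u
  adjacent⇒IsParent u w uw with position u | position w
  ... | centre refl | centre refl with () ← trans (sym (proj₂ simple v)) uw
  ... | centre refl | inner vw = inj₂ (inj₁ (vw , refl))
  ... | centre refl | outer w-outer with () ← trans (sym (proj₂ (isOuter⁻ w-outer))) uw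
  ... | inner vu | centre refl = inj₁ (inj₁ (vu , refl))
  ... | inner vu | inner vw = ⊥-elim (inner-inner-nonadjacent vu vw uw)
  ... | inner vu | outer w-outer = inj₂ (inj₂ (w-outer ,
    sym (parent-unique (parent-inner w w-outer) vu (proj₂ (parent-adjacent w w-outer)) uw w-outer)))
  ... | outer u-outer | centre refl with () ← trans (sym (proj₂ (isOuter⁻ u-outer))) (G-sym uw)
  ... | outer u-outer | inner vw = inj₁ (inj₂ (u-outer ,
    sym (parent-unique (parent-inner u u-outer) vw (proj₂ (parent-adjacent u u-outer)) (G-sym uw) u-outer)))
  ... | outer u-outer | outer w-outer = ⊥-elim (outer-outer-nonadjacent u-outer w-outer uw)

  adjacency-label : ∀ u w → G u w ≡ (isParentB n ν (label u) (label w) ∨ isParentB n ν (label w) (label u))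
  adjacency-label u w = true⇔true⇒≡ to from
    where
    to : G u w ≡ true → (isParentB n ν (label u) (label w) ∨ isParentB n ν (label w) (label u)) ≡ true
    to uw with adjacent⇒IsParent u w uw
    ... | inj₁ p = ∨-true⁺ˡ (IsParent⇒isParentB u w p)
    ... | inj₂ p = ∨-true⁺ʳ {isParentB n ν (label u) (label w)} (IsParent⇒isParentB w u p)
    from : (isParentB n ν (label u) (label w) ∨ isParentB n ν (label w) (label u)) ≡ true → G u w ≡ true
    from e with ∨-true⁻ {isParentB n ν (label u) (label w)} e
    ... | inj₁ p = IsParent⇒adjacent u w (isParentB⇒IsParent u w p)
    ... | inj₂ p = G-sym (IsParent⇒adjacent w u (isParentB⇒IsParent w u p))

  Tν-isomorphic : Isomorphic G (Tν n ν)
  Tν-isomorphic =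
    mk↔ₛ′ relabel (λ y → proj₁ (relabel-surjective y)) (λ y → proj₂ (relabel-surjective y))
          (λ u → relabel-injective _ _ (proj₂ (relabel-surjective (relabel u)))) ,
    λ u w → trans (adjacency-label u w)
                  (sym (cong₂ (λ i j → isParentB n ν i j ∨ isParentB n ν j i) (toℕ-relabel u) (toℕ-relabel w)))

corollary4 : (n : ℕ) → 1 ≤ n → (T : Adjacency (2 * n)) → IsSimple T → IsTree T →
    (∃ λ (v : Fin (2 * n)) → degree T v ≡ n) →
    SchurPositive (2 * n) (chromCoeff T) →
    ∃ λ (ν : List ℕ) → IsPartition (n ∸ 1) ν × Isomorphic T (Tν n ν)
corollary4 n n≥1 T simple tree (v , deg) schurPositive =
  let κ , proper , size₀ , size₁ =
        schurPositive⇒balancedColouring (2 * n) n simple tree v (2*n≡n+n n) schurPositive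
      withinTwo = balanced⇒withinTwo (proj₁ simple) (proj₁ tree) v deg κ proper size₀ size₁
      open RadiusTwo n n≥1 simple (proj₂ tree) v deg withinTwo
  in ν , ν-partition , Tν-isomorphic
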